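{- Let $\mathcal{K}=\mathbb{F}_q((x^{ -1}))$, $\mathcal{R}=\mathbb{F}_q[x]$, $1\le k\le n$, $m\ge1$, $\boldsymbol{\mu}=(\mu_1,\dots,\mu_m)\in(q^{\mathbb{Z}})^m$ with $\mu_1<\cdots<\mu_m$, $\boldsymbol{s}\in\mathbb{N}^m$, and let $\Lambda\le\mathcal{K}^n$ be a $(\boldsymbol{\mu},\boldsymbol{s})$-sublattice of dimension $k$ with successive minima $\lambda_i=\lambda_i(\Lambda)$. Fix an $\mathcal{R}$-basis $\mathbf{v}_1,\dots,\mathbf{v}_k$ of $\Lambda$ with $\Vert\mathbf{v}_i\Vert=\lambda_i$ for all $i$. For $1\le\ell\le m$ let $I_\ell=\{j\in\{1,\dots,k\}:\lambda_j=\mu_\ell\}$. Let $\mathbf{u}_j=\sum_{i=1}^k a_{i,j}\mathbf{v}_i$ with $a_{i,j}\in\mathcal{R}$, $1\le j\le k$, and suppose that $(\mathbf{u}_1,\dots,\mathbf{u}_k)$ is an $\mathcal{R}$-basis of $\Lambda$ with $\Vert\mathbf{u}_j\Vert=\lambda_j$ for all $j$. Then: \begin{enumerate} \item $|a_{i,j}|\le1$ (i.e. $a_{i,j}\in\mathbb{F}_q$) for all $i,j\in I_\ell$, $1\le\ell\le m$; \item $|a_{i,j}|\le\frac{\mu_\ell}{\mu_{\ell'}}$ for all $i\in I_{\ell'}$, $j\in I_\ell$ with $1\le\ell'<\ell\le m$; \item $a_{i,j}=0$ for all $i\in I_{\ell'}$, $j\in I_\ell$ with $1\le\ell<\ell'\le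 m$; \item for every $1\le\ell\le m$, the matrix $A_\ell=(a_{i,j})_{i,j\in I_\ell}$ is invertible over $\mathbb{F}_q$. \end{enumerate}
   Context: On $\mathcal{K}$ the absolute value is $|\sum_ia_ix^{ -i}|=q^{ -\min\{i:a_i\ne0\}}$ (so $|f|=q^{\deg f}$ for nonzero $f\in\mathcal{R}$), and $\mathcal{K}^n$ carries the norm $\Vert\mathbf{v}\Vert=\max_i|v_i|$. A $k$-sublattice is a subgroup $\Lambda=\mathcal{R}\mathbf{w}_1\oplus\cdots\oplus\mathcal{R}\mathbf{w}_k$ with $\mathbf{w}_i\in\mathcal{K}^n$ linearly independent over $\mathcal{K}$. Its successive minima are $\lambda_i(\Lambda)=\inf\{r>0:\dim\operatorname{span}_{\mathcal{K}}(\Lambda\cap\{\mathbf{v}:\Vert\mathbf{v}\Vert\le r\})\ge i\}$. $\Lambda$ is a $(\boldsymbol{\mu},\boldsymbol{s})$-sublattice if $\{\lambda_1(\Lambda),\dots,\lambda_k(\Lambda)\}=\{\mu_1,\dots,\mu_m\}$ and $|\{i:\lambda_i(\Lambda)=\mu_j\}|=s_j$ for each $j$. -}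

module Defs where

open import Level using (0ℓ)
open import Algebra.Bundles using (CommutativeRing)
open import Data.Bool using (Bool; true; false; if_then_else_; T)
open import Data.Nat as ℕ using (ℕ; zero; suc; _∸_)
open import Data.Integer as ℤ using (ℤ; +_; -[1+_])
open import Data.Fin as Fin using (Fin; toℕ)
open import Data.Product using (Σ; ∃; _×_; _,_)
open import Relation.Nullary using (¬_; does)
open import Relation.Binary.PropositionalEquality using (_≡_)

record IsFiniteField (F : CommutativeRing 0ℓ 0ℓ) (q : ℕ) : Set where
  open CommutativeRing F
  field
    0≉1       : ¬ (0# ≈ 1#)
    inverse   : ∀ x → ¬ (x ≈ 0#) → ∃ λ y → (x * y) ≈ 1#
    enum      : Fin q → Carrier
    enum-inj  : ∀ i j → enum i ≈ enum j → i ≡ j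
    enum-surj : ∀ x → ∃ λ i → enum i ≈ x

module Over (F : CommutativeRing 0ℓ 0ℓ) where
  open CommutativeRing F renaming (Carrier to 𝔽)

  sumℕ : ℕ → (ℕ → 𝔽) → 𝔽
  sumℕ zero    f = 0#
  sumℕ (suc n) f = sumℕ n f + f n

  sumFin : ∀ {k} → (Fin k → 𝔽) → 𝔽
  sumFin {zero}  f = 0#
  sumFin {suc k} f = f Fin.zero + sumFin (λ i → f (Fin.suc i))

  -- 𝒦 = 𝔽((x⁻¹)): a Laurent series  Σ_{j ≥ 0} seq j · x^(top - j)
  record 𝒦 : Set where
    constructor laurent
    field
      top : ℤ
      seq : ℕ → 𝔽

  atℤ : (ℕ → 𝔽) → ℤ → 𝔽
  atℤ s (+ j)      = s j
  atℤ s -[1+ _ ]   = 0#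

  coeff : 𝒦 → ℤ → 𝔽
  coeff (laurent N s) d = atℤ s (N ℤ.- d)

  _≈K_ : 𝒦 → 𝒦 → Set
  f ≈K g = ∀ d → coeff f d ≈ coeff g d

  0K : 𝒦
  0K = laurent (+ 0) (λ _ → 0#)

  _⊕_ : 𝒦 → 𝒦 → 𝒦
  f ⊕ g = laurent N (λ j → coeff f (N ℤ.- + j) + coeff g (N ℤ.- + j))
    where N = 𝒦.top f ℤ.⊔ 𝒦.top g

  _⊗_ : 𝒦 → 𝒦 → 𝒦
  laurent N s ⊗ laurent M t =
    laurent (N ℤ.+ M) (λ j → sumℕ (suc j) (λ i → s i * t (j ∸ i)))

  IsPoly : 𝒦 → Set
  IsPoly f = ∀ d → d ℤ.< + 0 → coeff f d ≈ 0#

  -- |f| ≤ q^e   (|f| = q^(max{d : coeff f d ≠ 0}), |0| = 0)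
  AbsLe : 𝒦 → ℤ → Set
  AbsLe f e = ∀ d → e ℤ.< d → coeff f d ≈ 0#

  Vec : ℕ → Set
  Vec n = Fin n → 𝒦

  _≈V_ : ∀ {n} → Vec n → Vec n → Set
  v ≈V w = ∀ i → v i ≈K w i

  0V : ∀ {n} → Vec n
  0V _ = 0K

  lincomb : ∀ {n k} → (Fin k → 𝒦) → (Fin k → Vec n) → Vec n
  lincomb {k = zero}  c w = 0V
  lincomb {k = suc k} c w = λ t →
    (c Fin.zero ⊗ w Fin.zero t) ⊕ lincomb (λ i → c (Fin.suc i)) (λ i → w (Fin.suc i)) t

  NormLe : ∀ {n} → Vec n → ℤ → Set
  NormLe v e = ∀ i → AbsLe (v i) e

  NormEq : ∀ {n} → Vec n → ℤ → Set
  NormEq v e = NormLe v e × ∃ λ i → ¬ (coeff (v i) e ≈ 0#)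

  KIndep : ∀ {n k} → (Fin k → Vec n) → Set
  KIndep w = ∀ c → lincomb c w ≈V 0V → ∀ i → c i ≈K 0K

  RIndep : ∀ {n k} → (Fin k → Vec n) → Set
  RIndep w = ∀ c → (∀ i → IsPoly (c i)) → lincomb c w ≈V 0V → ∀ i → c i ≈K 0K

  Mem : ∀ {n k} → (Fin k → Vec n) → Vec n → Set
  Mem w v = ∃ λ c → (∀ i → IsPoly (c i)) × (v ≈V lincomb c w)

  IsRBasis : ∀ {n k k'} → (Fin k → Vec n) → (Fin k' → Vec n) → Set
  IsRBasis w b = (∀ i → Mem w (b i)) × (∀ v → Mem w v → Mem b v) × RIndep b

  DimAtLeast : ∀ {n k} → (Fin k → Vec n) → ℤ → ℕ → Set
  DimAtLeast {n} w e i =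
    Σ (Fin i → Vec n) λ y → (∀ t → Mem w (y t) × NormLe (y t) e) × KIndep y

  -- λ_i(Λ) = q^e  (the infimum over r > 0 is attained at a power of q)
  IsSuccMin : ∀ {n k} → (Fin k → Vec n) → ℕ → ℤ → Set
  IsSuccMin w i e = DimAtLeast w e i × ¬ DimAtLeast w (e ℤ.- + 1) i

  countEq : ∀ {k} → (Fin k → ℤ) → ℤ → ℕ
  countEq {zero}  lam x = 0
  countEq {suc k} lam x =
    (if does (lam Fin.zero ℤ.≟ x) then 1 else 0) ℕ.+ countEq (λ t → lam (Fin.suc t)) x

  -- (μ, s)-sublattice condition, with λ_t = q^(lam t) and μ_ℓ = q^(e ℓ)
  IsMuS : ∀ {k m} → (Fin k → ℤ) → (Fin m → ℤ) → (Fin m → ℕ) → Set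
  IsMuS lam e s =
    (∀ t → ∃ λ ℓ → lam t ≡ e ℓ) × (∀ ℓ → ∃ λ t → lam t ≡ e ℓ) × (∀ ℓ → countEq lam (e ℓ) ≡ s ℓ)

  inI : ∀ {k} → (Fin k → ℤ) → ℤ → Fin k → Bool
  inI lam x t = does (lam t ℤ.≟ x)

  sumOn : ∀ {k} → (Fin k → Bool) → (Fin k → 𝔽) → 𝔽
  sumOn P f = sumFin (λ t → if P t then f t else 0#)

  δ : ∀ {k} → Fin k → Fin k → 𝔽
  δ i j = if does (i Fin.≟ j) then 1# else 0#

  InvertibleOn : ∀ {k} → (Fin k → Bool) → (Fin k → Fin k → 𝔽) → Set
  InvertibleOn {k} P A = Σ (Fin k → Fin k → 𝔽) λ B → ∀ i j → T (P i) → T (P j) →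
    (sumOn P (λ t → A i t * B t j) ≈ δ i j) × (sumOn P (λ t → B i t * A t j) ≈ δ i j)

-- A lattice vector Σ c_i b_i of norm ≤ q^E, written in an independent family of
-- lattice vectors b_i with ‖b_i‖ = λ_i, has |c_i| ≤ q^E / λ_i. Otherwise take the
-- largest level D > E reached by some term c_i b_i: the leading coefficients ρ_i of
-- these terms cancel in x^D, and for j maximising λ_j among ρ_j ≠ 0 the vector
-- Σ_i ρ_i x^(λ_j - λ_i) b_i lies in Λ, is shorter than λ_j and is independent of the
-- b_i with λ_i < λ_j, contradicting the definition of the successive minima.
-- Applied to the transition matrix a from v to u and to its inverse c this gives
-- |a_ij|, |c_ij| ≤ λ_j / λ_i, which is (1)-(3). Comparing constant terms in
-- a c = c a = 1, every term through an index outside a level set vanishes, so the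
-- diagonal blocks of constant terms are mutually inverse, which is (4).
-- Multiplication of Laurent series is handled by reading each coefficient of a
-- Cauchy product as a finite sum over any sufficiently long window.

module Submission where

open import Defs
open import Level using (0ℓ)
open import Algebra.Bundles using (CommutativeRing)
import Algebra.Properties.Ring as RingProperties
import Algebra.Properties.Semiring.Sum as SemiringSum
open import Data.Bool using (true; false; if_then_else_; T)
open import Data.Empty using (⊥; ⊥-elim)
open import Data.Fin as Fin using (Fin; Fin′; toℕ; inject)
import Data.Fin.Properties as FinP
open import Data.Integer as ℤ using (ℤ; +_; -[1+_]; 0ℤ; 1ℤ)
import Data.Integer.Properties as ℤP
open import Data.Integer.Tactic.RingSolver using (solve-∀)
open import Data.Nat as ℕ using (ℕ; zero; suc)
import Data.Nat.Properties as ℕP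
open import Data.Product using (_,_; proj₁; proj₂; ∃; _×_)
open import Data.Sum using (_⊎_; inj₁; inj₂)
open import Data.Vec.Functional using (_∷_)
open import Function using (_∘_; Injective)
open import Relation.Binary using (tri<; tri≈; tri>)
open import Relation.Binary.PropositionalEquality as P using (_≡_)
import Relation.Binary.Reasoning.Setoid as SetoidReasoning
open import Relation.Nullary using (¬_; ¬?; yes; no; Dec)
open import Relation.Unary using (Decidable)

-- Linear arithmetic over ℤ is done by hand: an inequality x ≤ y (or x < y)
-- is reduced to 0 ≤ y - x (or 0 ≤ y - x - 1), whose right side is obtained
-- from a sum of known nonnegative terms by a ring identity proved by solve-∀.

0≤-resp-≡ : ∀ {a b} → 0ℤ ℤ.≤ a → a ≡ b → 0ℤ ℤ.≤ b
0≤-resp-≡ p P.refl = p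

0≤+ : ∀ n → 0ℤ ℤ.≤ + n
0≤+ n = ℤ.+≤+ ℕ.z≤n

i<j⇒0≤j-i-1 : ∀ {i j} → i ℤ.< j → 0ℤ ℤ.≤ j ℤ.- i ℤ.- 1ℤ
i<j⇒0≤j-i-1 {i} {j} i<j = 0≤-resp-≡ (ℤP.i≤j⇒0≤j-i (ℤP.i<j⇒suc[i]≤j i<j)) (shift i j)
  where
  shift : ∀ i j → j ℤ.- (1ℤ ℤ.+ i) ≡ j ℤ.- i ℤ.- 1ℤ
  shift = solve-∀

0≤j-i-1⇒i<j : ∀ {i j} → 0ℤ ℤ.≤ j ℤ.- i ℤ.- 1ℤ → i ℤ.< j
0≤j-i-1⇒i<j {i} {j} p = ℤP.suc[i]≤j⇒i<j (ℤP.0≤i-j⇒j≤i (0≤-resp-≡ p (shift i j)))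
  where
  shift : ∀ i j → j ℤ.- i ℤ.- 1ℤ ≡ j ℤ.- (1ℤ ℤ.+ i)
  shift = solve-∀

i<j⇒i≤j-1 : ∀ {i j} → i ℤ.< j → i ℤ.≤ j ℤ.- 1ℤ
i<j⇒i≤j-1 {i} {j} i<j = P.subst (i ℤ.≤_) (ℤP.+-comm ℤ.-1ℤ j) (ℤP.i<j⇒i≤pred[j] i<j)

i<j⇒i-j<0 : ∀ {i j} → i ℤ.< j → i ℤ.- j ℤ.< 0ℤ
i<j⇒i-j<0 {i} {j} i<j = 0≤j-i-1⇒i<j (0≤-resp-≡ (i<j⇒0≤j-i-1 i<j) (identity i j))
  where
  identity : ∀ i j → j ℤ.- i ℤ.- 1ℤ ≡ 0ℤ ℤ.- (i ℤ.- j) ℤ.- 1ℤ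
  identity = solve-∀

i-j<0⇒i<j : ∀ {i j} → i ℤ.- j ℤ.< 0ℤ → i ℤ.< j
i-j<0⇒i<j {i} {j} p = 0≤j-i-1⇒i<j (0≤-resp-≡ (i<j⇒0≤j-i-1 p) (identity i j))
  where
  identity : ∀ i j → 0ℤ ℤ.- (i ℤ.- j) ℤ.- 1ℤ ≡ j ℤ.- i ℤ.- 1ℤ
  identity = solve-∀

pos-∸ : ∀ {m n} → n ℕ.≤ m → + (m ℕ.∸ n) ≡ + m ℤ.- + n
pos-∸ {m} {n} n≤m = P.trans (P.sym (ℤP.⊖-≥ n≤m)) (P.sym (ℤP.m-n≡m⊖n m n))

i≤j⇒∃[n]j≡i+n : ∀ {i j} → i ℤ.≤ j → ∃ λ n → j ≡ i ℤ.+ + n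
i≤j⇒∃[n]j≡i+n {i} {j} i≤j = ℤ.∣ j ℤ.- i ∣ , P.trans (P.sym (cancel i j)) (P.cong (λ z → i ℤ.+ z) (P.sym (ℤP.0≤i⇒+∣i∣≡i (ℤP.i≤j⇒0≤j-i i≤j))))
  where
  cancel : ∀ i j → i ℤ.+ (j ℤ.- i) ≡ j
  cancel = solve-∀

∃-length-below : ∀ t B → ∃ λ L → t ℤ.- + L ℤ.< B
∃-length-below t B = suc n , 0≤j-i-1⇒i<j (0≤-resp-≡ (ℤP.i≤j⇒0≤j-i (i≤+∣i∣ (t ℤ.- B))) (identity t B (+ n)))
  where
  n : ℕ
  n = ℤ.∣ t ℤ.- B ∣
  i≤+∣i∣ : ∀ i → i ℤ.≤ + ℤ.∣ i ∣
  i≤+∣i∣ (+ _)    = ℤP.≤-refl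
  i≤+∣i∣ -[1+ _ ] = ℤ.-≤+
  identity : ∀ t B n → n ℤ.- (t ℤ.- B) ≡ B ℤ.- (t ℤ.- (1ℤ ℤ.+ n)) ℤ.- 1ℤ
  identity = solve-∀

module Windows (F : CommutativeRing 0ℓ 0ℓ) where
  open CommutativeRing F renaming (Carrier to 𝔽)
  open Over F using (sumℕ)
  open SetoidReasoning setoid

  sumℕ-cong< : ∀ L {f g : ℕ → 𝔽} → (∀ i → i ℕ.< L → f i ≈ g i) → sumℕ L f ≈ sumℕ L g
  sumℕ-cong< zero    f≈g = refl
  sumℕ-cong< (suc L) f≈g = +-cong (sumℕ-cong< L (λ i i<L → f≈g i (ℕP.m<n⇒m<1+n i<L))) (f≈g L (ℕP.n<1+n L))

  sumℕ-cong : ∀ L {f g : ℕ → 𝔽} → (∀ i → f i ≈ g i) → sumℕ L f ≈ sumℕ L g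
  sumℕ-cong L f≈g = sumℕ-cong< L (λ i _ → f≈g i)

  sumℕ-zero : ∀ L (f : ℕ → 𝔽) → (∀ i → i ℕ.< L → f i ≈ 0#) → sumℕ L f ≈ 0#
  sumℕ-zero zero    f f≈0 = refl
  sumℕ-zero (suc L) f f≈0 =
    trans (+-cong (sumℕ-zero L f (λ i i<L → f≈0 i (ℕP.m<n⇒m<1+n i<L))) (f≈0 L (ℕP.n<1+n L))) (+-identityˡ 0#)

  sumℕ-distrib-+ : ∀ L (f g : ℕ → 𝔽) → sumℕ L (λ i → f i + g i) ≈ sumℕ L f + sumℕ L g
  sumℕ-distrib-+ zero    f g = sym (+-identityˡ 0#)
  sumℕ-distrib-+ (suc L) f g = begin
    sumℕ L (λ i → f i + g i) + (f L + g L) ≈⟨ +-congʳ (sumℕ-distrib-+ L f g) ⟩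
    (sumℕ L f + sumℕ L g) + (f L + g L)   ≈⟨ interchange _ _ _ _ ⟩
    (sumℕ L f + f L) + (sumℕ L g + g L)   ∎
    where open import Algebra.Properties.CommutativeSemigroup +-commutativeSemigroup using (interchange)

  *-distribˡ-sumℕ : ∀ L x (f : ℕ → 𝔽) → x * sumℕ L f ≈ sumℕ L (λ i → x * f i)
  *-distribˡ-sumℕ zero    x f = zeroʳ x
  *-distribˡ-sumℕ (suc L) x f = trans (distribˡ x _ _) (+-congʳ (*-distribˡ-sumℕ L x f))

  *-distribʳ-sumℕ : ∀ L x (f : ℕ → 𝔽) → sumℕ L f * x ≈ sumℕ L (λ i → f i * x)
  *-distribʳ-sumℕ L x f =
    trans (*-comm _ x) (trans (*-distribˡ-sumℕ L x f) (sumℕ-cong L (λ i → *-comm x (f i))))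

  sumℕ-head : ∀ L (f : ℕ → 𝔽) → sumℕ (suc L) f ≈ f 0 + sumℕ L (f ∘ suc)
  sumℕ-head zero    f = +-comm 0# (f 0)
  sumℕ-head (suc L) f = trans (+-congʳ (sumℕ-head L f)) (+-assoc _ _ _)

  sumℕ-reverse : ∀ L (f : ℕ → 𝔽) → sumℕ L f ≈ sumℕ L (λ i → f (L ℕ.∸ suc i))
  sumℕ-reverse zero    f = refl
  sumℕ-reverse (suc L) f = begin
    sumℕ L f + f L                         ≈⟨ +-congʳ (sumℕ-reverse L f) ⟩
    sumℕ L (λ i → f (L ℕ.∸ suc i)) + f L   ≈⟨ +-comm _ _ ⟩
    f L + sumℕ L (λ i → f (L ℕ.∸ suc i))   ≈⟨ sumℕ-head L (λ i → f (suc L ℕ.∸ suc i)) ⟨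
    sumℕ (suc L) (λ i → f (suc L ℕ.∸ suc i)) ∎

  sumℕ-comm : ∀ L M (h : ℕ → ℕ → 𝔽) → sumℕ L (λ i → sumℕ M (h i)) ≈ sumℕ M (λ j → sumℕ L (λ i → h i j))
  sumℕ-comm zero    M h = sym (sumℕ-zero M (λ _ → 0#) (λ _ _ → refl))
  sumℕ-comm (suc L) M h = begin
    sumℕ L (λ i → sumℕ M (h i)) + sumℕ M (h L)          ≈⟨ +-congʳ (sumℕ-comm L M h) ⟩
    sumℕ M (λ j → sumℕ L (λ i → h i j)) + sumℕ M (h L)  ≈⟨ sumℕ-distrib-+ M _ _ ⟨
    sumℕ M (λ j → sumℕ (suc L) (λ i → h i j))           ∎

  sumℕ-pad : ∀ L (f : ℕ → 𝔽) → (∀ i → L ℕ.≤ i → f i ≈ 0#) → ∀ r → sumℕ (r ℕ.+ L) f ≈ sumℕ L f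
  sumℕ-pad L f f≈0 zero    = refl
  sumℕ-pad L f f≈0 (suc r) = trans (+-cong (sumℕ-pad L f f≈0 r) (f≈0 (r ℕ.+ L) (ℕP.m≤n+m L r))) (+-identityʳ _)

  window : (ℤ → 𝔽) → ℤ → ℕ → 𝔽
  window φ t L = sumℕ L (λ i → φ (t ℤ.- + i))

  window-cong : ∀ {φ ψ : ℤ → 𝔽} → (∀ a → φ a ≈ ψ a) → ∀ t L → window φ t L ≈ window ψ t L
  window-cong φ≈ψ t L = sumℕ-cong L (λ i → φ≈ψ _)

  window-lower-top : ∀ (φ : ℤ → 𝔽) t L → φ (t ℤ.+ 1ℤ) ≈ 0# → window φ (t ℤ.+ 1ℤ) (suc L) ≈ window φ t L
  window-lower-top φ t L φ≈0 = begin
    window φ (t ℤ.+ 1ℤ) (suc L)                                   ≈⟨ sumℕ-head L _ ⟩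
    φ (t ℤ.+ 1ℤ ℤ.- 0ℤ) + sumℕ L (λ i → φ (t ℤ.+ 1ℤ ℤ.- + suc i)) ≈⟨ +-cong first rest ⟩
    0# + window φ t L                                             ≈⟨ +-identityˡ _ ⟩
    window φ t L                                                  ∎
    where
    no-shift : ∀ t → t ℤ.+ 1ℤ ℤ.- 0ℤ ≡ t ℤ.+ 1ℤ
    no-shift = solve-∀
    shift : ∀ t i → t ℤ.+ 1ℤ ℤ.- (1ℤ ℤ.+ i) ≡ t ℤ.- i
    shift = solve-∀
    first : φ (t ℤ.+ 1ℤ ℤ.- 0ℤ) ≈ 0#
    first = trans (reflexive (P.cong φ (no-shift t))) φ≈0
    rest : sumℕ L (λ i → φ (t ℤ.+ 1ℤ ℤ.- + suc i)) ≈ window φ t L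
    rest = sumℕ-cong L (λ i → reflexive (P.cong φ (P.trans (P.cong (λ z → t ℤ.+ 1ℤ ℤ.- z) (ℤP.pos-+ 1 i)) (shift t (+ i)))))

  window-raise-top : ∀ (φ : ℤ → 𝔽) t L → (∀ a → t ℤ.< a → φ a ≈ 0#) →
                     ∀ p → window φ (t ℤ.+ + p) (p ℕ.+ L) ≈ window φ t L
  window-raise-top φ t L φ≈0 zero    = reflexive (P.cong (λ t' → window φ t' L) (ℤP.+-identityʳ t))
  window-raise-top φ t L φ≈0 (suc p) = begin
    window φ (t ℤ.+ + suc p) (suc p ℕ.+ L)       ≈⟨ reflexive (P.cong (λ t' → window φ t' (suc p ℕ.+ L)) top≡) ⟩
    window φ (t ℤ.+ + p ℤ.+ 1ℤ) (suc (p ℕ.+ L))  ≈⟨ window-lower-top φ (t ℤ.+ + p) (p ℕ.+ L) (φ≈0 _ t<top) ⟩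
    window φ (t ℤ.+ + p) (p ℕ.+ L)               ≈⟨ window-raise-top φ t L φ≈0 p ⟩
    window φ t L                                 ∎
    where
    assoc : ∀ t p → t ℤ.+ (1ℤ ℤ.+ p) ≡ t ℤ.+ p ℤ.+ 1ℤ
    assoc = solve-∀
    gap : ∀ t p → p ≡ t ℤ.+ p ℤ.+ 1ℤ ℤ.- t ℤ.- 1ℤ
    gap = solve-∀
    top≡ : t ℤ.+ + suc p ≡ t ℤ.+ + p ℤ.+ 1ℤ
    top≡ = P.trans (P.cong (λ z → t ℤ.+ z) (ℤP.pos-+ 1 p)) (assoc t (+ p))
    t<top : t ℤ.< t ℤ.+ + p ℤ.+ 1ℤ
    t<top = 0≤j-i-1⇒i<j (0≤-resp-≡ (0≤+ p) (gap t (+ p)))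

  window-lengthen : ∀ (φ : ℤ → 𝔽) t L B → (∀ a → a ℤ.< B → φ a ≈ 0#) → t ℤ.- + L ℤ.< B →
                    ∀ r → window φ t (r ℕ.+ L) ≈ window φ t L
  window-lengthen φ t L B φ≈0 below = sumℕ-pad L _ (λ i L≤i → φ≈0 _ (ℤP.≤-<-trans (lower i L≤i) below))
    where
    identity : ∀ t i L → (t ℤ.- L) ℤ.- (t ℤ.- i) ≡ i ℤ.- L
    identity = solve-∀
    lower : ∀ i → L ℕ.≤ i → t ℤ.- + i ℤ.≤ t ℤ.- + L
    lower i L≤i = ℤP.0≤i-j⇒j≤i (0≤-resp-≡ (ℤP.i≤j⇒0≤j-i (ℤ.+≤+ L≤i)) (P.sym (identity t (+ i) (+ L))))

  window-length-irrelevant : ∀ (φ : ℤ → 𝔽) t B → (∀ a → a ℤ.< B → φ a ≈ 0#) → ∀ L₁ L₂ →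
                             t ℤ.- + L₁ ℤ.< B → t ℤ.- + L₂ ℤ.< B → window φ t L₁ ≈ window φ t L₂
  window-length-irrelevant φ t B φ≈0 L₁ L₂ below₁ below₂ with ℕP.≤-total L₁ L₂
  ... | inj₁ L₁≤L₂ = sym (trans (reflexive (P.cong (window φ t) (P.sym (ℕP.m∸n+n≡m L₁≤L₂))))
                                (window-lengthen φ t L₁ B φ≈0 below₁ (L₂ ℕ.∸ L₁)))
  ... | inj₂ L₂≤L₁ = trans (reflexive (P.cong (window φ t) (P.sym (ℕP.m∸n+n≡m L₂≤L₁))))
                           (window-lengthen φ t L₂ B φ≈0 below₂ (L₁ ℕ.∸ L₂))

  window-irrelevant-≤ : ∀ (φ : ℤ → 𝔽) T B → (∀ a → T ℤ.< a → φ a ≈ 0#) → (∀ a → a ℤ.< B → φ a ≈ 0#) →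
                        ∀ t₁ L₁ t₂ L₂ → T ℤ.≤ t₁ → t₁ ℤ.- + L₁ ℤ.< B → t₁ ℤ.≤ t₂ → t₂ ℤ.- + L₂ ℤ.< B →
                        window φ t₁ L₁ ≈ window φ t₂ L₂
  window-irrelevant-≤ φ T B above below t₁ L₁ t₂ L₂ T≤t₁ end₁ t₁≤t₂ end₂ with i≤j⇒∃[n]j≡i+n t₁≤t₂
  ... | p , P.refl = begin
    window φ t₁ L₁                   ≈⟨ window-raise-top φ t₁ L₁ (λ a t₁<a → above a (ℤP.≤-<-trans T≤t₁ t₁<a)) p ⟨
    window φ (t₁ ℤ.+ + p) (p ℕ.+ L₁) ≈⟨ window-length-irrelevant φ (t₁ ℤ.+ + p) B below (p ℕ.+ L₁) L₂ end₁′ end₂ ⟩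
    window φ (t₁ ℤ.+ + p) L₂         ∎
    where
    identity : ∀ t p L → t ℤ.+ p ℤ.- (p ℤ.+ L) ≡ t ℤ.- L
    identity = solve-∀
    end₁′ : t₁ ℤ.+ + p ℤ.- + (p ℕ.+ L₁) ℤ.< B
    end₁′ = P.subst (ℤ._< B) (P.sym (P.trans (P.cong (λ z → t₁ ℤ.+ + p ℤ.- z) (ℤP.pos-+ p L₁)) (identity t₁ (+ p) (+ L₁)))) end₁

  window-irrelevant : ∀ (φ : ℤ → 𝔽) T B → (∀ a → T ℤ.< a → φ a ≈ 0#) → (∀ a → a ℤ.< B → φ a ≈ 0#) →
                      ∀ t₁ L₁ t₂ L₂ → T ℤ.≤ t₁ → t₁ ℤ.- + L₁ ℤ.< B → T ℤ.≤ t₂ → t₂ ℤ.- + L₂ ℤ.< B →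
                      window φ t₁ L₁ ≈ window φ t₂ L₂
  window-irrelevant φ T B above below t₁ L₁ t₂ L₂ T≤t₁ end₁ T≤t₂ end₂ with ℤP.≤-total t₁ t₂
  ... | inj₁ t₁≤t₂ = window-irrelevant-≤ φ T B above below t₁ L₁ t₂ L₂ T≤t₁ end₁ t₁≤t₂ end₂
  ... | inj₂ t₂≤t₁ = sym (window-irrelevant-≤ φ T B above below t₂ L₂ t₁ L₁ T≤t₂ end₂ t₂≤t₁ end₁)

module LaurentCoefficients (F : CommutativeRing 0ℓ 0ℓ) where
  open CommutativeRing F renaming (Carrier to 𝔽)
  open Over F
  open Windows F
  open RingProperties ring using (-0#≈0#)
  open SetoidReasoning setoid

  top : 𝒦 → ℤ
  top = 𝒦.top

  atℤ-negative : ∀ (s : ℕ → 𝔽) x → x ℤ.< 0ℤ → atℤ s x ≈ 0#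
  atℤ-negative s (+ j)    (ℤ.+<+ ())
  atℤ-negative s -[1+ n ] _ = refl

  atℤ-cases : ∀ (s : ℕ → 𝔽) x r → (∀ j → x ≡ + j → s j ≈ r) → (x ℤ.< 0ℤ → 0# ≈ r) → atℤ s x ≈ r
  atℤ-cases s (+ j)    r nonneg neg = nonneg j P.refl
  atℤ-cases s -[1+ n ] r nonneg neg = neg ℤ.-<+

  coeff-cong : ∀ f {d d'} → d ≡ d' → coeff f d ≈ coeff f d'
  coeff-cong f d≡d' = reflexive (P.cong (coeff f) d≡d')

  coeff-above-top : ∀ f d → top f ℤ.< d → coeff f d ≈ 0#
  coeff-above-top (laurent N s) d N<d = atℤ-negative s (N ℤ.- d) (i<j⇒i-j<0 N<d)

  coeff-below-top : ∀ f j → coeff f (top f ℤ.- + j) ≈ 𝒦.seq f j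
  coeff-below-top (laurent N s) j = reflexive (P.cong (atℤ s) (cancel N (+ j)))
    where
    cancel : ∀ N j → N ℤ.- (N ℤ.- j) ≡ j
    cancel = solve-∀

  coeff-0K : ∀ d → coeff 0K d ≈ 0#
  coeff-0K d with 0ℤ ℤ.- d
  ... | + j      = refl
  ... | -[1+ _ ] = refl

  coeff-⊕ : ∀ f g d → coeff (f ⊕ g) d ≈ coeff f d + coeff g d
  coeff-⊕ f g d = atℤ-cases _ (N ℤ.- d) _ inside outside
    where
    N : ℤ
    N = top f ℤ.⊔ top g
    cancel : ∀ N d → N ℤ.- (N ℤ.- d) ≡ d
    cancel = solve-∀
    inside : ∀ j → N ℤ.- d ≡ + j → coeff f (N ℤ.- + j) + coeff g (N ℤ.- + j) ≈ coeff f d + coeff g d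
    inside j N-d≡j = +-cong (coeff-cong f d≡) (coeff-cong g d≡)
      where
      d≡ : N ℤ.- + j ≡ d
      d≡ = P.trans (P.cong (λ z → N ℤ.- z) (P.sym N-d≡j)) (cancel N d)
    outside : N ℤ.- d ℤ.< 0ℤ → 0# ≈ coeff f d + coeff g d
    outside N-d<0 = sym (trans (+-cong (coeff-above-top f d (ℤP.≤-<-trans (ℤP.i≤i⊔j (top f) (top g)) N<d))
                                      (coeff-above-top g d (ℤP.≤-<-trans (ℤP.i≤j⊔i (top f) (top g)) N<d)))
                               (+-identityˡ 0#))
      where
      N<d : N ℤ.< d
      N<d = i-j<0⇒i<j N-d<0

  ⊖_ : 𝒦 → 𝒦
  ⊖ f = laurent (top f) (λ j → - 𝒦.seq f j)

  coeff-⊖ : ∀ f d → coeff (⊖ f) d ≈ - coeff f d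
  coeff-⊖ (laurent N s) d with N ℤ.- d
  ... | + j      = refl
  ... | -[1+ _ ] = sym -0#≈0#

  monomial : 𝔽 → ℤ → 𝒦
  monomial ρ e = laurent e λ { zero → ρ ; (suc _) → 0# }

  coeff-monomial : ∀ ρ e → coeff (monomial ρ e) e ≈ ρ
  coeff-monomial ρ e = trans (coeff-cong (monomial ρ e) (P.sym (ℤP.+-identityʳ e))) (coeff-below-top (monomial ρ e) 0)

  coeff-monomial-≢ : ∀ ρ e a → ¬ (a ≡ e) → coeff (monomial ρ e) a ≈ 0#
  coeff-monomial-≢ ρ e a a≢e with ℤP.<-cmp a e
  ... | tri≈ _ a≡e _ = ⊥-elim (a≢e a≡e)
  ... | tri> _ _ e<a = coeff-above-top (monomial ρ e) a e<a
  ... | tri< a<e _ _ = positive (e ℤ.- a) (i<j⇒0≤j-i-1 a<e)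
    where
    positive : ∀ x → 0ℤ ℤ.≤ x ℤ.- 1ℤ → atℤ (𝒦.seq (monomial ρ e)) x ≈ 0#
    positive (+ zero)  ()
    positive (+ suc n) _ = refl
    positive -[1+ n ]  _ = refl

  convolution : 𝒦 → 𝒦 → ℤ → ℤ → 𝔽
  convolution f g d a = coeff f a * coeff g (d ℤ.- a)

  convolution-above : ∀ f g d a → top f ℤ.< a → convolution f g d a ≈ 0#
  convolution-above f g d a top<a = trans (*-congʳ (coeff-above-top f a top<a)) (zeroˡ _)

  convolution-below : ∀ f g d a → a ℤ.< d ℤ.- top g → convolution f g d a ≈ 0#
  convolution-below f g d a a<d-top =
    trans (*-congˡ (coeff-above-top g _ (0≤j-i-1⇒i<j (0≤-resp-≡ (i<j⇒0≤j-i-1 a<d-top) (identity a d (top g)))))) (zeroʳ _)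
    where
    identity : ∀ a d M → d ℤ.- M ℤ.- a ℤ.- 1ℤ ≡ d ℤ.- a ℤ.- M ℤ.- 1ℤ
    identity = solve-∀

  coeff-⊗ : ∀ f g d t L → top f ℤ.≤ t → t ℤ.- + L ℤ.< d ℤ.- top g →
            coeff (f ⊗ g) d ≈ window (convolution f g d) t L
  coeff-⊗ f@(laurent N s) g@(laurent M u) d t L N≤t end = atℤ-cases _ (N ℤ.+ M ℤ.- d) _ inside outside
    where
    φ : ℤ → 𝔽
    φ = convolution f g d
    term : ∀ N M d i → M ℤ.- (d ℤ.- (N ℤ.- i)) ≡ (N ℤ.+ M ℤ.- d) ℤ.- i
    term = solve-∀
    lowest : ∀ N M d → 0ℤ ≡ d ℤ.- M ℤ.- (N ℤ.- (1ℤ ℤ.+ (N ℤ.+ M ℤ.- d))) ℤ.- 1ℤ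
    lowest = solve-∀
    inside : ∀ j → N ℤ.+ M ℤ.- d ≡ + j → sumℕ (suc j) (λ i → s i * u (j ℕ.∸ i)) ≈ window φ t L
    inside j N+M-d≡j = begin
      sumℕ (suc j) (λ i → s i * u (j ℕ.∸ i)) ≈⟨ sumℕ-cong< (suc j) (λ i i≤j → *-cong (sym (coeff-below-top f i)) (u-index i i≤j)) ⟩
      window φ N (suc j)                     ≈⟨ window-irrelevant φ N (d ℤ.- M) (convolution-above f g d) (convolution-below f g d)
                                                                  N (suc j) t L ℤP.≤-refl endN N≤t end ⟩
      window φ t L                           ∎
      where
      u-index : ∀ i → i ℕ.< suc j → u (j ℕ.∸ i) ≈ coeff g (d ℤ.- (N ℤ.- + i))
      u-index i (ℕ.s≤s i≤j) = reflexive (P.cong (atℤ u) (P.sym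
        (P.trans (term N M d (+ i)) (P.trans (P.cong (λ z → z ℤ.- + i) N+M-d≡j) (P.sym (pos-∸ i≤j))))))
      endN : N ℤ.- + suc j ℤ.< d ℤ.- M
      endN = 0≤j-i-1⇒i<j (0≤-resp-≡ ℤP.≤-refl (P.trans (lowest N M d)
               (P.cong (λ z → d ℤ.- M ℤ.- (N ℤ.- z) ℤ.- 1ℤ) (P.trans (P.cong (λ z → 1ℤ ℤ.+ z) N+M-d≡j) (P.sym (ℤP.pos-+ 1 j))))))
    outside : N ℤ.+ M ℤ.- d ℤ.< 0ℤ → 0# ≈ window φ t L
    outside N+M-d<0 = sym (sumℕ-zero L _ (λ i _ → vanishes _))
      where
      identity : ∀ N M d a → N ℤ.- a ℤ.+ (d ℤ.- (N ℤ.+ M) ℤ.- 1ℤ) ≡ d ℤ.- M ℤ.- a ℤ.- 1ℤ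
      identity = solve-∀
      vanishes : ∀ a → φ a ≈ 0#
      vanishes a with a ℤ.≤? N
      ... | no a≰N = convolution-above f g d a (ℤP.≰⇒> a≰N)
      ... | yes a≤N = convolution-below f g d a (0≤j-i-1⇒i<j (0≤-resp-≡
              (ℤP.+-mono-≤ (ℤP.i≤j⇒0≤j-i a≤N) (i<j⇒0≤j-i-1 (i-j<0⇒i<j {N ℤ.+ M} {d} N+M-d<0))) (identity N M d a)))

  coeff-⊗-single : ∀ f g d a₀ → (∀ a → a₀ ℤ.< a → convolution f g d a ≈ 0#) → (∀ a → a ℤ.< a₀ → convolution f g d a ≈ 0#) →
                   coeff (f ⊗ g) d ≈ convolution f g d a₀
  coeff-⊗-single f g d a₀ above below with ∃-length-below (top f ℤ.⊔ a₀) ((d ℤ.- top g) ℤ.⊓ a₀)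
  ... | L , end = begin
    coeff (f ⊗ g) d ≈⟨ coeff-⊗ f g d t L (ℤP.i≤i⊔j _ _) (ℤP.<-≤-trans end (ℤP.i⊓j≤i _ _)) ⟩
    window φ t L    ≈⟨ window-irrelevant φ a₀ a₀ above below t L a₀ 1 (ℤP.i≤j⊔i _ _) (ℤP.<-≤-trans end (ℤP.i⊓j≤j _ _))
                                         ℤP.≤-refl a₀-1<a₀ ⟩
    0# + φ (a₀ ℤ.- 0ℤ) ≈⟨ +-identityˡ _ ⟩
    φ (a₀ ℤ.- 0ℤ)   ≈⟨ reflexive (P.cong φ (ℤP.+-identityʳ a₀)) ⟩
    φ a₀            ∎
    where
    t : ℤ
    t = top f ℤ.⊔ a₀
    φ : ℤ → 𝔽
    φ = convolution f g d
    identity : ∀ a → 0ℤ ≡ a ℤ.- (a ℤ.- 1ℤ) ℤ.- 1ℤ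
    identity = solve-∀
    a₀-1<a₀ : a₀ ℤ.- + 1 ℤ.< a₀
    a₀-1<a₀ = 0≤j-i-1⇒i<j (0≤-resp-≡ ℤP.≤-refl (identity a₀))

  coeff-monomial-⊗ : ∀ ρ e f d → coeff (monomial ρ e ⊗ f) d ≈ ρ * coeff f (d ℤ.- e)
  coeff-monomial-⊗ ρ e f d = trans (coeff-⊗-single (monomial ρ e) f d e
      (λ a e<a → convolution-above (monomial ρ e) f d a e<a)
      (λ a a<e → trans (*-congʳ (coeff-monomial-≢ ρ e a (ℤP.<⇒≢ a<e))) (zeroˡ _)))
    (*-congʳ (coeff-monomial ρ e))

module LaurentRing (F : CommutativeRing 0ℓ 0ℓ) where
  open CommutativeRing F renaming (Carrier to 𝔽)
  open Over F
  open Windows F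
  open LaurentCoefficients F
  open SetoidReasoning setoid

  1K : 𝒦
  1K = monomial 1# 0ℤ

  ⊕-cong : ∀ {f f' g g'} → f ≈K f' → g ≈K g' → (f ⊕ g) ≈K (f' ⊕ g')
  ⊕-cong {f} {f'} {g} {g'} f≈f' g≈g' d = trans (coeff-⊕ f g d) (trans (+-cong (f≈f' d) (g≈g' d)) (sym (coeff-⊕ f' g' d)))

  ⊕-comm : ∀ f g → (f ⊕ g) ≈K (g ⊕ f)
  ⊕-comm f g d = trans (coeff-⊕ f g d) (trans (+-comm _ _) (sym (coeff-⊕ g f d)))

  ⊕-assoc : ∀ f g h → ((f ⊕ g) ⊕ h) ≈K (f ⊕ (g ⊕ h))
  ⊕-assoc f g h d = begin
    coeff ((f ⊕ g) ⊕ h) d               ≈⟨ trans (coeff-⊕ (f ⊕ g) h d) (+-congʳ (coeff-⊕ f g d)) ⟩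
    (coeff f d + coeff g d) + coeff h d ≈⟨ +-assoc _ _ _ ⟩
    coeff f d + (coeff g d + coeff h d) ≈⟨ trans (coeff-⊕ f (g ⊕ h) d) (+-congˡ (coeff-⊕ g h d)) ⟨
    coeff (f ⊕ (g ⊕ h)) d               ∎

  ⊕-identityˡ : ∀ f → (0K ⊕ f) ≈K f
  ⊕-identityˡ f d = trans (coeff-⊕ 0K f d) (trans (+-congʳ (coeff-0K d)) (+-identityˡ _))

  ⊕-identityʳ : ∀ f → (f ⊕ 0K) ≈K f
  ⊕-identityʳ f d = trans (⊕-comm f 0K d) (⊕-identityˡ f d)

  ⊖-cong : ∀ {f g} → f ≈K g → (⊖ f) ≈K (⊖ g)
  ⊖-cong {f} {g} f≈g d = trans (coeff-⊖ f d) (trans (-‿cong (f≈g d)) (sym (coeff-⊖ g d)))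

  ⊕-inverseˡ : ∀ f → ((⊖ f) ⊕ f) ≈K 0K
  ⊕-inverseˡ f d = trans (coeff-⊕ (⊖ f) f d) (trans (+-congʳ (coeff-⊖ f d)) (trans (-‿inverseˡ _) (sym (coeff-0K d))))

  ⊕-inverseʳ : ∀ f → (f ⊕ (⊖ f)) ≈K 0K
  ⊕-inverseʳ f d = trans (⊕-comm f (⊖ f) d) (⊕-inverseˡ f d)

  ⊗-cong : ∀ {f f' g g'} → f ≈K f' → g ≈K g' → (f ⊗ g) ≈K (f' ⊗ g')
  ⊗-cong {f} {f'} {g} {g'} f≈f' g≈g' d with ∃-length-below (top f ℤ.⊔ top f') ((d ℤ.- top g) ℤ.⊓ (d ℤ.- top g'))
  ... | L , end = begin
    coeff (f ⊗ g) d                     ≈⟨ coeff-⊗ f g d t L (ℤP.i≤i⊔j _ _) (ℤP.<-≤-trans end (ℤP.i⊓j≤i _ _)) ⟩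
    window (convolution f g d) t L      ≈⟨ window-cong (λ a → *-cong (f≈f' a) (g≈g' (d ℤ.- a))) t L ⟩
    window (convolution f' g' d) t L    ≈⟨ coeff-⊗ f' g' d t L (ℤP.i≤j⊔i _ _) (ℤP.<-≤-trans end (ℤP.i⊓j≤j _ _)) ⟨
    coeff (f' ⊗ g') d                   ∎
    where
    t : ℤ
    t = top f ℤ.⊔ top f'

  -- Reversing the window turns the convolution of f and g into that of g and f.
  ⊗-comm : ∀ f g → (f ⊗ g) ≈K (g ⊗ f)
  ⊗-comm f g d = begin
    coeff (f ⊗ g) d                                          ≈⟨ coeff-⊗ f g d N (suc n) ℤP.≤-refl end ⟩
    window (convolution f g d) N (suc n)                     ≈⟨ sumℕ-reverse (suc n) _ ⟩
    sumℕ (suc n) (λ i → convolution f g d (N ℤ.- + (n ℕ.∸ i))) ≈⟨ sumℕ-cong< (suc n) swap ⟩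
    window (convolution g f d) t' (suc n)                    ≈⟨ coeff-⊗ g f d t' (suc n) M≤t' end' ⟨
    coeff (g ⊗ f) d                                          ∎
    where
    N M : ℤ
    N = top f
    M = top g
    n : ℕ
    n = ℤ.∣ N ℤ.- (d ℤ.- M) ∣
    end : N ℤ.- + suc n ℤ.< d ℤ.- M
    end = proj₂ (∃-length-below N (d ℤ.- M))
    t' : ℤ
    t' = d ℤ.- N ℤ.+ + n
    index-g : ∀ d N n i → d ℤ.- (N ℤ.- (n ℤ.- i)) ≡ (d ℤ.- N ℤ.+ n) ℤ.- i
    index-g = solve-∀
    index-f : ∀ d N n i → N ℤ.- (n ℤ.- i) ≡ d ℤ.- ((d ℤ.- N ℤ.+ n) ℤ.- i)
    index-f = solve-∀
    swap : ∀ i → i ℕ.< suc n → convolution f g d (N ℤ.- + (n ℕ.∸ i)) ≈ convolution g f d (t' ℤ.- + i)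
    swap i (ℕ.s≤s i≤n) = trans (*-comm _ _) (*-cong
      (coeff-cong g (P.trans (P.cong (λ z → d ℤ.- (N ℤ.- z)) (pos-∸ i≤n)) (index-g d N (+ n) (+ i))))
      (coeff-cong f (P.trans (P.cong (λ z → N ℤ.- z) (pos-∸ i≤n)) (index-f d N (+ n) (+ i)))))
    identity-M : ∀ d N M n → d ℤ.- M ℤ.- (N ℤ.- (1ℤ ℤ.+ n)) ℤ.- 1ℤ ≡ (d ℤ.- N ℤ.+ n) ℤ.- M
    identity-M = solve-∀
    identity-end : ∀ d N n → 0ℤ ≡ d ℤ.- N ℤ.- ((d ℤ.- N ℤ.+ n) ℤ.- (1ℤ ℤ.+ n)) ℤ.- 1ℤ
    identity-end = solve-∀
    M≤t' : M ℤ.≤ t'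
    M≤t' = ℤP.0≤i-j⇒j≤i (0≤-resp-≡ (i<j⇒0≤j-i-1 end)
             (P.trans (P.cong (λ z → d ℤ.- M ℤ.- (N ℤ.- z) ℤ.- 1ℤ) (ℤP.pos-+ 1 n)) (identity-M d N M (+ n))))
    end' : t' ℤ.- + suc n ℤ.< d ℤ.- N
    end' = 0≤j-i-1⇒i<j (0≤-resp-≡ ℤP.≤-refl
             (P.trans (identity-end d N (+ n)) (P.cong (λ z → d ℤ.- N ℤ.- (t' ℤ.- z) ℤ.- 1ℤ) (P.sym (ℤP.pos-+ 1 n)))))

  -- Both bracketings of f ⊗ g ⊗ h have the same double sum as their x^d-coefficient.
  module TripleProduct (f g h : 𝒦) (d : ℤ) (L : ℕ) (end : top f ℤ.+ top g ℤ.- + L ℤ.< d ℤ.- top h) where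
    N M : ℤ
    N = top f
    M = top g
    a : ℕ → ℤ
    a i = N ℤ.+ M ℤ.- + i
    b : ℕ → ℤ
    b j = N ℤ.- + j

    triple-sum : 𝔽
    triple-sum = sumℕ L (λ j → sumℕ L (λ i → coeff f (b j) * (coeff g (a i ℤ.- b j) * coeff h (d ℤ.- a i))))

    coeff-[⊗]⊗ : coeff ((f ⊗ g) ⊗ h) d ≈ triple-sum
    coeff-[⊗]⊗ = begin
      coeff ((f ⊗ g) ⊗ h) d
        ≈⟨ coeff-⊗ (f ⊗ g) h d (N ℤ.+ M) L ℤP.≤-refl end ⟩
      sumℕ L (λ i → coeff (f ⊗ g) (a i) * coeff h (d ℤ.- a i))
        ≈⟨ sumℕ-cong< L (λ i i<L → *-congʳ (coeff-⊗ f g (a i) N L ℤP.≤-refl (inner-end i i<L))) ⟩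
      sumℕ L (λ i → window (convolution f g (a i)) N L * coeff h (d ℤ.- a i))
        ≈⟨ sumℕ-cong L (λ i → *-distribʳ-sumℕ L _ _) ⟩
      sumℕ L (λ i → sumℕ L (λ j → convolution f g (a i) (b j) * coeff h (d ℤ.- a i)))
        ≈⟨ sumℕ-comm L L _ ⟩
      sumℕ L (λ j → sumℕ L (λ i → convolution f g (a i) (b j) * coeff h (d ℤ.- a i)))
        ≈⟨ sumℕ-cong L (λ j → sumℕ-cong L (λ i → *-assoc _ _ _)) ⟩
      triple-sum ∎
      where
      identity : ∀ N M L i → L ℤ.- i ℤ.- 1ℤ ≡ (N ℤ.+ M ℤ.- i) ℤ.- M ℤ.- (N ℤ.- L) ℤ.- 1ℤ
      identity = solve-∀
      inner-end : ∀ i → i ℕ.< L → N ℤ.- + L ℤ.< a i ℤ.- M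
      inner-end i i<L = 0≤j-i-1⇒i<j (0≤-resp-≡ (i<j⇒0≤j-i-1 (ℤ.+<+ i<L)) (identity N M (+ L) (+ i)))

    coeff-⊗[⊗] : coeff (f ⊗ (g ⊗ h)) d ≈ triple-sum
    coeff-⊗[⊗] = begin
      coeff (f ⊗ (g ⊗ h)) d
        ≈⟨ coeff-⊗ f (g ⊗ h) d N L ℤP.≤-refl outer-end ⟩
      sumℕ L (λ j → coeff f (b j) * coeff (g ⊗ h) (d ℤ.- b j))
        ≈⟨ sumℕ-cong L (λ j → *-congˡ (coeff-⊗ g h (d ℤ.- b j) (c j) L (M≤c j) (inner-end j))) ⟩
      sumℕ L (λ j → coeff f (b j) * window (convolution g h (d ℤ.- b j)) (c j) L)
        ≈⟨ sumℕ-cong L (λ j → trans (*-distribˡ-sumℕ L _ _) (sumℕ-cong L (λ i → *-congˡ (reindex i j)))) ⟩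
      triple-sum ∎
      where
      Q : ℤ
      Q = top h
      c : ℕ → ℤ
      c j = N ℤ.+ M ℤ.- b j
      index-g : ∀ N M i bj → (N ℤ.+ M ℤ.- bj) ℤ.- i ≡ (N ℤ.+ M ℤ.- i) ℤ.- bj
      index-g = solve-∀
      index-h : ∀ N M d i bj → (d ℤ.- bj) ℤ.- ((N ℤ.+ M ℤ.- bj) ℤ.- i) ≡ d ℤ.- (N ℤ.+ M ℤ.- i)
      index-h = solve-∀
      reindex : ∀ i j → convolution g h (d ℤ.- b j) (c j ℤ.- + i) ≈ coeff g (a i ℤ.- b j) * coeff h (d ℤ.- a i)
      reindex i j = *-cong (coeff-cong g (index-g N M (+ i) (b j))) (coeff-cong h (index-h N M d (+ i) (b j)))
      identity-c : ∀ N M j → j ≡ (N ℤ.+ M ℤ.- (N ℤ.- j)) ℤ.- M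
      identity-c = solve-∀
      M≤c : ∀ j → M ℤ.≤ c j
      M≤c j = ℤP.0≤i-j⇒j≤i (0≤-resp-≡ (0≤+ j) (identity-c N M (+ j)))
      identity-inner : ∀ N M Q d L bj → d ℤ.- Q ℤ.- (N ℤ.+ M ℤ.- L) ℤ.- 1ℤ
                                      ≡ (d ℤ.- bj) ℤ.- Q ℤ.- ((N ℤ.+ M ℤ.- bj) ℤ.- L) ℤ.- 1ℤ
      identity-inner = solve-∀
      inner-end : ∀ j → c j ℤ.- + L ℤ.< (d ℤ.- b j) ℤ.- Q
      inner-end j = 0≤j-i-1⇒i<j (0≤-resp-≡ (i<j⇒0≤j-i-1 end) (identity-inner N M Q d (+ L) (b j)))
      identity-outer : ∀ N M Q d L → d ℤ.- Q ℤ.- (N ℤ.+ M ℤ.- L) ℤ.- 1ℤ ≡ d ℤ.- (M ℤ.+ Q) ℤ.- (N ℤ.- L) ℤ.- 1ℤ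
      identity-outer = solve-∀
      outer-end : N ℤ.- + L ℤ.< d ℤ.- top (g ⊗ h)
      outer-end = 0≤j-i-1⇒i<j (0≤-resp-≡ (i<j⇒0≤j-i-1 end) (identity-outer N M Q d (+ L)))

  ⊗-assoc : ∀ f g h → ((f ⊗ g) ⊗ h) ≈K (f ⊗ (g ⊗ h))
  ⊗-assoc f g h d with ∃-length-below (top f ℤ.+ top g) (d ℤ.- top h)
  ... | L , end = trans coeff-[⊗]⊗ (sym coeff-⊗[⊗])
    where open TripleProduct f g h d L end

  ⊗-identityˡ : ∀ f → (1K ⊗ f) ≈K f
  ⊗-identityˡ f d = begin
    coeff (1K ⊗ f) d           ≈⟨ coeff-monomial-⊗ 1# 0ℤ f d ⟩
    1# * coeff f (d ℤ.- 0ℤ)    ≈⟨ *-identityˡ _ ⟩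
    coeff f (d ℤ.- 0ℤ)         ≈⟨ coeff-cong f (ℤP.+-identityʳ d) ⟩
    coeff f d                  ∎

  ⊗-distribˡ : ∀ f g h → (f ⊗ (g ⊕ h)) ≈K ((f ⊗ g) ⊕ (f ⊗ h))
  ⊗-distribˡ f g h d with ∃-length-below (top f) (d ℤ.- (top g ℤ.⊔ top h))
  ... | L , end = begin
    coeff (f ⊗ (g ⊕ h)) d                                    ≈⟨ coeff-⊗ f (g ⊕ h) d N L ℤP.≤-refl end ⟩
    window (convolution f (g ⊕ h) d) N L                     ≈⟨ window-cong distrib-term N L ⟩
    sumℕ L (λ i → convolution f g d (N ℤ.- + i) + convolution f h d (N ℤ.- + i)) ≈⟨ sumℕ-distrib-+ L _ _ ⟩
    window (convolution f g d) N L + window (convolution f h d) N L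
      ≈⟨ +-cong (coeff-⊗ f g d N L ℤP.≤-refl (ℤP.<-≤-trans end (lower (ℤP.i≤i⊔j (top g) (top h)))))
                (coeff-⊗ f h d N L ℤP.≤-refl (ℤP.<-≤-trans end (lower (ℤP.i≤j⊔i (top g) (top h))))) ⟨
    coeff (f ⊗ g) d + coeff (f ⊗ h) d                        ≈⟨ coeff-⊕ (f ⊗ g) (f ⊗ h) d ⟨
    coeff ((f ⊗ g) ⊕ (f ⊗ h)) d                              ∎
    where
    N : ℤ
    N = top f
    distrib-term : ∀ a → convolution f (g ⊕ h) d a ≈ convolution f g d a + convolution f h d a
    distrib-term a = trans (*-congˡ (coeff-⊕ g h (d ℤ.- a))) (distribˡ _ _ _)
    lower : ∀ {x y} → y ℤ.≤ x → d ℤ.- x ℤ.≤ d ℤ.- y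
    lower = ℤP.+-monoʳ-≤ d ∘ ℤP.neg-mono-≤

  -- A record, so that the ring equality is injective in its arguments and the implicit
  -- arguments of generic ring lemmas can be inferred.
  infix 4 _≃_
  record _≃_ (f g : 𝒦) : Set where
    constructor mk≃
    field coeffwise : f ≈K g
  open _≃_ public

  𝒦-commutativeRing : CommutativeRing 0ℓ 0ℓ
  𝒦-commutativeRing = record
    { Carrier = 𝒦 ; _≈_ = _≃_ ; _+_ = _⊕_ ; _*_ = _⊗_ ; -_ = ⊖_ ; 0# = 0K ; 1# = 1K
    ; isCommutativeRing = record
      { isRing = record
        { +-isAbelianGroup = record
          { isGroup = record
            { isMonoid = record
              { isSemigroup = record
                { isMagma = record
                  { isEquivalence = record
                     { refl  = mk≃ (λ d → refl)
                     ; sym   = λ (mk≃ e) → mk≃ (λ d → sym (e d))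
                     ; trans = λ (mk≃ e) (mk≃ e') → mk≃ (λ d → trans (e d) (e' d)) }
                  ; ∙-cong = λ {f} {f'} {g} {g'} (mk≃ e) (mk≃ e') → mk≃ (⊕-cong {f} {f'} {g} {g'} e e') }
                ; assoc = λ f g h → mk≃ (⊕-assoc f g h) }
              ; identity = (λ f → mk≃ (⊕-identityˡ f)) , (λ f → mk≃ (⊕-identityʳ f)) }
            ; inverse = (λ f → mk≃ (⊕-inverseˡ f)) , (λ f → mk≃ (⊕-inverseʳ f))
            ; ⁻¹-cong = λ {f} {g} (mk≃ e) → mk≃ (⊖-cong {f} {g} e) }
          ; comm = λ f g → mk≃ (⊕-comm f g) }
        ; *-cong = λ {f} {f'} {g} {g'} (mk≃ e) (mk≃ e') → mk≃ (⊗-cong {f} {f'} {g} {g'} e e')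
        ; *-assoc = λ f g h → mk≃ (⊗-assoc f g h)
        ; *-identity = (λ f → mk≃ (⊗-identityˡ f)) , (λ f → mk≃ (λ d → trans (⊗-comm f 1K d) (⊗-identityˡ f d)))
        ; distrib = (λ f g h → mk≃ (⊗-distribˡ f g h))
                  , (λ f g h → mk≃ (λ d → trans (⊗-comm (g ⊕ h) f d)
                                          (trans (⊗-distribˡ f g h d) (⊕-cong {f ⊗ g} {g ⊗ f} {f ⊗ h} {h ⊗ f} (⊗-comm f g) (⊗-comm f h) d))))
        }
      ; *-comm = λ f g → mk≃ (⊗-comm f g) }
    }

module FiniteSums (R : CommutativeRing 0ℓ 0ℓ) where
  open CommutativeRing R
  open Over R using (δ; sumFin)
  open SemiringSum semiring public
    using (sum; sum-cong-≋; sum-replicate-zero; ∑-distrib-+; ∑-comm; *-distribˡ-sum; *-distribʳ-sum)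
  open RingProperties ring using (-‿distribˡ-*)
  open SetoidReasoning setoid

  sumFin≈sum : ∀ {k} (f : Fin k → Carrier) → sumFin f ≈ sum f
  sumFin≈sum {zero}  f = refl
  sumFin≈sum {suc k} f = +-congˡ (sumFin≈sum (f ∘ Fin.suc))

  sum-zero : ∀ {k} (f : Fin k → Carrier) → (∀ i → f i ≈ 0#) → sum f ≈ 0#
  sum-zero {k} f f≈0 = trans (sum-cong-≋ f≈0) (sum-replicate-zero k)

  sum-neg : ∀ {k} (f : Fin k → Carrier) → sum (λ i → - f i) ≈ - sum f
  sum-neg f = begin
    sum (λ i → - f i)        ≈⟨ sum-cong-≋ (λ i → trans (-‿cong (sym (*-identityˡ (f i)))) (-‿distribˡ-* 1# (f i))) ⟩
    sum (λ i → - 1# * f i)   ≈⟨ *-distribˡ-sum (- 1#) f ⟨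
    - 1# * sum f             ≈⟨ -‿distribˡ-* 1# _ ⟨
    - (1# * sum f)           ≈⟨ -‿cong (*-identityˡ _) ⟩
    - sum f                  ∎

  sum-matrix : ∀ {k m} (c : Fin k → Carrier) (P : Fin k → Fin m → Carrier) (Q : Fin m → Carrier) →
               sum (λ i → c i * sum (λ t → P i t * Q t)) ≈ sum (λ t → sum (λ i → c i * P i t) * Q t)
  sum-matrix c P Q = begin
    sum (λ i → c i * sum (λ t → P i t * Q t))   ≈⟨ sum-cong-≋ (λ i → *-distribˡ-sum (c i) (λ t → P i t * Q t)) ⟩
    sum (λ i → sum (λ t → c i * (P i t * Q t))) ≈⟨ ∑-comm (λ i t → c i * (P i t * Q t)) ⟩
    sum (λ t → sum (λ i → c i * (P i t * Q t))) ≈⟨ sum-cong-≋ (λ t → sum-cong-≋ (λ i → *-assoc (c i) (P i t) (Q t))) ⟨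
    sum (λ t → sum (λ i → (c i * P i t) * Q t)) ≈⟨ sum-cong-≋ (λ t → *-distribʳ-sum (Q t) (λ i → c i * P i t)) ⟨
    sum (λ t → sum (λ i → c i * P i t) * Q t)   ∎

  δ-refl : ∀ {k} (i : Fin k) → δ i i ≈ 1#
  δ-refl i with i Fin.≟ i
  ... | yes _  = refl
  ... | no i≢i = ⊥-elim (i≢i P.refl)

  δ-≢ : ∀ {k} {i j : Fin k} → ¬ (i ≡ j) → δ i j ≈ 0#
  δ-≢ {i = i} {j} i≢j with i Fin.≟ j
  ... | yes i≡j = ⊥-elim (i≢j i≡j)
  ... | no _    = refl

  δ-sym : ∀ {k} (i j : Fin k) → δ i j ≈ δ j i
  δ-sym i j with i Fin.≟ j | j Fin.≟ i
  ... | yes _   | yes _   = refl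
  ... | no _    | no _    = refl
  ... | yes i≡j | no j≢i  = ⊥-elim (j≢i (P.sym i≡j))
  ... | no i≢j  | yes j≡i = ⊥-elim (i≢j (P.sym j≡i))

  δ-injective : ∀ {r k} (ι : Fin r → Fin k) → Injective _≡_ _≡_ ι → ∀ a b → δ (ι a) (ι b) ≈ δ a b
  δ-injective ι ι-inj a b with ι a Fin.≟ ι b | a Fin.≟ b
  ... | yes _   | yes _   = refl
  ... | no _    | no _    = refl
  ... | yes ιa≡ιb | no a≢b = ⊥-elim (a≢b (ι-inj ιa≡ιb))
  ... | no ιa≢ιb | yes a≡b = ⊥-elim (ιa≢ιb (P.cong ι a≡b))

  sum-*-δ : ∀ {k} (f : Fin k → Carrier) (j : Fin k) → sum (λ i → f i * δ i j) ≈ f j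
  sum-*-δ {suc k} f Fin.zero = begin
    f Fin.zero * δ {suc k} Fin.zero Fin.zero + sum (λ i → f (Fin.suc i) * δ (Fin.suc i) Fin.zero)
      ≈⟨ +-cong (trans (*-congˡ (δ-refl {suc k} Fin.zero)) (*-identityʳ _))
                (sum-zero (λ i → f (Fin.suc i) * δ (Fin.suc i) Fin.zero)
                          (λ i → trans (*-congˡ (δ-≢ {i = Fin.suc i} {Fin.zero} λ ())) (zeroʳ (f (Fin.suc i))))) ⟩
    f Fin.zero + 0#  ≈⟨ +-identityʳ _ ⟩
    f Fin.zero       ∎
  sum-*-δ {suc k} f (Fin.suc j) = begin
    f Fin.zero * δ Fin.zero (Fin.suc j) + sum (λ i → f (Fin.suc i) * δ (Fin.suc i) (Fin.suc j))
      ≈⟨ +-cong (trans (*-congˡ (δ-≢ {i = Fin.zero} {Fin.suc j} λ ())) (zeroʳ _))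
                (sum-cong-≋ (λ i → *-congˡ (δ-injective {k} Fin.suc FinSuc-injective i j))) ⟩
    0# + sum (λ i → f (Fin.suc i) * δ i j) ≈⟨ +-identityˡ _ ⟩
    sum (λ i → f (Fin.suc i) * δ i j)      ≈⟨ sum-*-δ (f ∘ Fin.suc) j ⟩
    f (Fin.suc j)                          ∎
    where
    FinSuc-injective : ∀ {k} → Injective _≡_ _≡_ (Fin.suc {k})
    FinSuc-injective P.refl = P.refl

module LinearAlgebra (F : CommutativeRing 0ℓ 0ℓ) where
  open Over F hiding (δ)
  open LaurentCoefficients F
  open LaurentRing F
  module 𝔽 = CommutativeRing F
  module Σ𝔽 = FiniteSums F
  open CommutativeRing 𝒦-commutativeRing
  open FiniteSums 𝒦-commutativeRing
  open Over 𝒦-commutativeRing using (δ)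
  open SetoidReasoning setoid

  lincomb≃sum : ∀ {n k} (c : Fin k → 𝒦) (w : Fin k → Vec n) t → lincomb c w t ≃ sum (λ i → c i * w i t)
  lincomb≃sum {k = zero}  c w t = refl
  lincomb≃sum {k = suc k} c w t = +-congˡ (lincomb≃sum (c ∘ Fin.suc) (w ∘ Fin.suc) t)

  lincomb-cong : ∀ {n k} {c c' : Fin k → 𝒦} {w w' : Fin k → Vec n} → (∀ i → c i ≃ c' i) → (∀ i t → w i t ≃ w' i t) →
                 ∀ t → lincomb c w t ≃ lincomb c' w' t
  lincomb-cong {c = c} {c'} {w} {w'} c≃c' w≃w' t =
    trans (lincomb≃sum c w t) (trans (sum-cong-≋ (λ i → *-cong (c≃c' i) (w≃w' i t))) (sym (lincomb≃sum c' w' t)))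

  lincomb-lincomb : ∀ {n k m} (c : Fin m → 𝒦) (M : Fin m → Fin k → 𝒦) (w : Fin k → Vec n) t →
                    lincomb c (λ p → lincomb (M p) w) t ≃ lincomb (λ s → sum (λ p → c p * M p s)) w t
  lincomb-lincomb c M w t = begin
    lincomb c (λ p → lincomb (M p) w) t      ≈⟨ lincomb≃sum c (λ p → lincomb (M p) w) t ⟩
    sum (λ p → c p * lincomb (M p) w t)      ≈⟨ sum-cong-≋ (λ p → *-congˡ {c p} (lincomb≃sum (M p) w t)) ⟩
    sum (λ p → c p * sum (λ s → M p s * w s t)) ≈⟨ sum-matrix c M (λ s → w s t) ⟩
    sum (λ s → sum (λ p → c p * M p s) * w s t) ≈⟨ lincomb≃sum (λ s → sum (λ p → c p * M p s)) w t ⟨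
    lincomb (λ s → sum (λ p → c p * M p s)) w t ∎

  lincomb-δ : ∀ {n k} (w : Fin k → Vec n) j t → lincomb (λ i → δ i j) w t ≃ w j t
  lincomb-δ w j t = begin
    lincomb (λ i → δ i j) w t  ≈⟨ lincomb≃sum (λ i → δ i j) w t ⟩
    sum (λ i → δ i j * w i t)  ≈⟨ sum-cong-≋ (λ i → *-comm (δ i j) (w i t)) ⟩
    sum (λ i → w i t * δ i j)  ≈⟨ sum-*-δ (λ i → w i t) j ⟩
    w j t                      ∎

  lincomb-sub : ∀ {n k} (c c' : Fin k → 𝒦) (w : Fin k → Vec n) t →
                lincomb (λ i → c i - c' i) w t ≃ lincomb c w t - lincomb c' w t
  lincomb-sub c c' w t = begin
    lincomb (λ i → c i - c' i) w t                      ≈⟨ lincomb≃sum (λ i → c i - c' i) w t ⟩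
    sum (λ i → (c i - c' i) * w i t)                    ≈⟨ sum-cong-≋ distrib-neg ⟩
    sum (λ i → c i * w i t - c' i * w i t)              ≈⟨ ∑-distrib-+ (λ i → c i * w i t) (λ i → - (c' i * w i t)) ⟩
    sum (λ i → c i * w i t) + sum (λ i → - (c' i * w i t)) ≈⟨ +-congˡ (sum-neg (λ i → c' i * w i t)) ⟩
    sum (λ i → c i * w i t) - sum (λ i → c' i * w i t)  ≈⟨ +-cong (lincomb≃sum c w t) (-‿cong (lincomb≃sum c' w t)) ⟨
    lincomb c w t - lincomb c' w t                      ∎
    where
    open RingProperties ring using (-‿distribˡ-*)
    distrib-neg : ∀ i → (c i - c' i) * w i t ≃ c i * w i t - c' i * w i t
    distrib-neg i = trans (distribʳ (w i t) (c i) (- c' i)) (+-congˡ (sym (-‿distribˡ-* (c' i) (w i t))))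

  coeff-sum : ∀ {k} (f : Fin k → 𝒦) d → coeff (sum f) d 𝔽.≈ Σ𝔽.sum (λ i → coeff (f i) d)
  coeff-sum {zero}  f d = coeff-0K d
  coeff-sum {suc k} f d = 𝔽.trans (coeff-⊕ (f Fin.zero) (sum (f ∘ Fin.suc)) d) (𝔽.+-congˡ (coeff-sum (f ∘ Fin.suc) d))

  coeff-lincomb : ∀ {n k} (c : Fin k → 𝒦) (w : Fin k → Vec n) s d →
                  coeff (lincomb c w s) d 𝔽.≈ Σ𝔽.sum (λ i → coeff (c i ⊗ w i s) d)
  coeff-lincomb c w s d = 𝔽.trans (coeffwise (lincomb≃sum c w s) d) (coeff-sum (λ i → c i ⊗ w i s) d)

  NormLe-mono : ∀ {n} (v : Vec n) {e e'} → e ℤ.≤ e' → NormLe v e → NormLe v e'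
  NormLe-mono v e≤e' ‖v‖≤e i d e'<d = ‖v‖≤e i d (ℤP.≤-<-trans e≤e' e'<d)

  DimAtLeast-mono : ∀ {n k} (w : Fin k → Vec n) {e e'} i → e ℤ.≤ e' → DimAtLeast w e i → DimAtLeast w e' i
  DimAtLeast-mono w i e≤e' (y , y-short , y-indep) =
    y , (λ t → proj₁ (y-short t) , NormLe-mono (y t) e≤e' (proj₂ (y-short t))) , y-indep

  IsPoly-⊕ : ∀ {f g} → IsPoly f → IsPoly g → IsPoly (f ⊕ g)
  IsPoly-⊕ {f} {g} f-poly g-poly d d<0 =
    𝔽.trans (coeff-⊕ f g d) (𝔽.trans (𝔽.+-cong (f-poly d d<0) (g-poly d d<0)) (𝔽.+-identityˡ 𝔽.0#))

  IsPoly-⊖ : ∀ {f} → IsPoly f → IsPoly (⊖ f)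
  IsPoly-⊖ {f} f-poly d d<0 = 𝔽.trans (coeff-⊖ f d) (𝔽.trans (𝔽.-‿cong (f-poly d d<0)) -0#≈0#)
    where open RingProperties 𝔽.ring using (-0#≈0#)

  IsPoly-⊗ : ∀ {f g} → IsPoly f → IsPoly g → IsPoly (f ⊗ g)
  IsPoly-⊗ {f} {g} f-poly g-poly d d<0 with ∃-length-below (top f) (d ℤ.- top g)
  ... | L , end = 𝔽.trans (coeff-⊗ f g d (top f) L ℤP.≤-refl end) (Windows.sumℕ-zero F L _ (λ i _ → vanishes _))
    where
    identity : ∀ a d → 0ℤ ℤ.- d ℤ.- 1ℤ ℤ.+ (a ℤ.- 0ℤ) ≡ 0ℤ ℤ.- (d ℤ.- a) ℤ.- 1ℤ
    identity = solve-∀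
    vanishes : ∀ a → convolution f g d a 𝔽.≈ 𝔽.0#
    vanishes a with a ℤ.<? 0ℤ
    ... | yes a<0 = 𝔽.trans (𝔽.*-congʳ (f-poly a a<0)) (𝔽.zeroˡ _)
    ... | no a≮0  = 𝔽.trans (𝔽.*-congˡ (g-poly (d ℤ.- a) (0≤j-i-1⇒i<j (0≤-resp-≡
                      (ℤP.+-mono-≤ (i<j⇒0≤j-i-1 d<0) (ℤP.i≤j⇒0≤j-i (ℤP.≮⇒≥ a≮0))) (identity a d))))) (𝔽.zeroʳ _)

  IsPoly-monomial : ∀ ρ e → 0ℤ ℤ.≤ e → IsPoly (monomial ρ e)
  IsPoly-monomial ρ e 0≤e d d<0 = coeff-monomial-≢ ρ e d (λ d≡e → ℤP.<-irrefl P.refl (ℤP.<-≤-trans d<0 (P.subst (0ℤ ℤ.≤_) (P.sym d≡e) 0≤e)))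

  IsPoly-zero-monomial : ∀ ρ e → ρ 𝔽.≈ 𝔽.0# → IsPoly (monomial ρ e)
  IsPoly-zero-monomial ρ e ρ≈0 d _ with d ℤ.≟ e
  ... | yes P.refl = 𝔽.trans (coeff-monomial ρ d) ρ≈0
  ... | no d≢e     = coeff-monomial-≢ ρ e d d≢e

  coeff₀-⊗ : ∀ f g → IsPoly f → IsPoly g → coeff (f ⊗ g) 0ℤ 𝔽.≈ coeff f 0ℤ 𝔽.* coeff g 0ℤ
  coeff₀-⊗ f g f-poly g-poly = 𝔽.trans (coeff-⊗-single f g 0ℤ 0ℤ
      (λ a 0<a → 𝔽.trans (𝔽.*-congˡ (g-poly (0ℤ ℤ.- a) (i<j⇒i-j<0 0<a))) (𝔽.zeroʳ _))
      (λ a a<0 → 𝔽.trans (𝔽.*-congʳ (f-poly a a<0)) (𝔽.zeroˡ _)))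
    (𝔽.*-congˡ (coeff-cong g (ℤP.+-identityʳ 0ℤ)))

  IsPoly∧AbsLe-negative⇒≈0 : ∀ {f e} → IsPoly f → AbsLe f e → e ℤ.< 0ℤ → f ≈K 0K
  IsPoly∧AbsLe-negative⇒≈0 {f} {e} f-poly |f|≤e e<0 d with d ℤ.<? 0ℤ
  ... | yes d<0 = 𝔽.trans (f-poly d d<0) (𝔽.sym (coeff-0K d))
  ... | no d≮0  = 𝔽.trans (|f|≤e d (ℤP.<-≤-trans e<0 (ℤP.≮⇒≥ d≮0))) (𝔽.sym (coeff-0K d))

  IsPoly-0K : IsPoly 0K
  IsPoly-0K d _ = coeff-0K d

  IsPoly-sum : ∀ {k} (f : Fin k → 𝒦) → (∀ i → IsPoly (f i)) → IsPoly (sum f)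
  IsPoly-sum {zero}  f f-poly = IsPoly-0K
  IsPoly-sum {suc k} f f-poly = IsPoly-⊕ {f Fin.zero} {sum (f ∘ Fin.suc)} (f-poly Fin.zero) (IsPoly-sum (f ∘ Fin.suc) (f-poly ∘ Fin.suc))

  IsPoly-δ : ∀ {k} (i j : Fin k) → IsPoly (δ i j)
  IsPoly-δ i j with i Fin.≟ j
  ... | yes _ = IsPoly-monomial 𝔽.1# 0ℤ ℤP.≤-refl
  ... | no _  = IsPoly-0K

  Mem-generator : ∀ {n k} (w : Fin k → Vec n) j → Mem w (w j)
  Mem-generator w j = (λ i → δ i j) , (λ i → IsPoly-δ i j) , (λ t → coeffwise (sym (lincomb-δ w j t)))

  Mem-lincomb : ∀ {n k m} (w : Fin k → Vec n) (Y : Fin m → Vec n) (g : Fin m → 𝒦) →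
                (∀ p → Mem w (Y p)) → (∀ p → IsPoly (g p)) → Mem w (lincomb g Y)
  Mem-lincomb w Y g Y∈Λ g-poly =
    (λ s → sum (λ p → g p * M p s)) ,
    (λ s → IsPoly-sum _ (λ p → IsPoly-⊗ {g p} {M p s} (g-poly p) (proj₁ (proj₂ (Y∈Λ p)) s))) ,
    (λ t → coeffwise (trans (lincomb-cong (λ p → refl) (λ p t' → mk≃ (proj₂ (proj₂ (Y∈Λ p)) t')) t) (lincomb-lincomb g M w t)))
    where
    M : _ → Fin _ → 𝒦
    M p = proj₁ (Y∈Λ p)

  RIndep⇒coefficients-unique : ∀ {n k} (b : Fin k → Vec n) → RIndep b → (X Y : Fin k → 𝒦) →
                               (∀ s → IsPoly (X s)) → (∀ s → IsPoly (Y s)) →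
                               (∀ t → lincomb X b t ≃ lincomb Y b t) → ∀ s → X s ≃ Y s
  RIndep⇒coefficients-unique b b-indep X Y X-poly Y-poly X≃Y s =
    x-y≈0⇒x≈y (mk≃ (b-indep (λ s → X s - Y s) (λ s → IsPoly-⊕ {X s} { - Y s} (X-poly s) (IsPoly-⊖ {Y s} (Y-poly s)))
       (λ t → coeffwise (begin
          lincomb (λ s → X s - Y s) b t  ≈⟨ lincomb-sub X Y b t ⟩
          lincomb X b t - lincomb Y b t  ≈⟨ +-congʳ (X≃Y t) ⟩
          lincomb Y b t - lincomb Y b t  ≈⟨ -‿inverseʳ _ ⟩
          0K                             ∎)) s))
    where
    x-y≈0⇒x≈y : ∀ {x y} → x - y ≃ 0K → x ≃ y
    x-y≈0⇒x≈y {x} {y} x-y≃0 = begin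
      x             ≈⟨ +-identityʳ x ⟨
      x + 0K        ≈⟨ +-congˡ (-‿inverseˡ y) ⟨
      x + (- y + y) ≈⟨ +-assoc _ _ _ ⟨
      (x - y) + y   ≈⟨ +-congʳ x-y≃0 ⟩
      0K + y        ≈⟨ +-identityˡ y ⟩
      y             ∎

  KIndep-lincomb-rows : ∀ {n k m} (b : Fin k → Vec n) → KIndep b → (M : Fin m → Fin k → 𝒦) (Y : Fin m → Vec n) →
                        (∀ p t → Y p t ≃ lincomb (M p) b t) → ∀ κ → lincomb κ Y ≈V 0V →
                        ∀ i → sum (λ p → κ p * M p i) ≈K 0K
  KIndep-lincomb-rows b b-indep M Y Y≃ κ κY≈0 = b-indep _ (λ t → coeffwise (begin
    lincomb (λ i → sum (λ p → κ p * M p i)) b t ≈⟨ lincomb-lincomb κ M b t ⟨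
    lincomb κ (λ p → lincomb (M p) b) t         ≈⟨ lincomb-cong {c = κ} (λ _ → refl) (λ p t' → sym (Y≃ p t')) t ⟩
    lincomb κ Y t                               ≈⟨ mk≃ (κY≈0 t) ⟩
    0K                                          ∎))

  IsRBasis⇒KIndep : ∀ {n k k'} (w : Fin k → Vec n) (b : Fin k' → Vec n) → KIndep w → IsRBasis w b → KIndep b
  IsRBasis⇒KIndep w b w-indep (b∈Λ , Λ⊆b , b-indep) κ κb≈0 s = coeffwise (begin
    κ s                                    ≈⟨ sum-*-δ κ s ⟨
    sum (λ i → κ i * δ i s)                ≈⟨ sum-cong-≋ (λ i → *-congˡ {κ i} (trans (δ-sym i s) (sym (PQ≃δ i s)))) ⟩
    sum (λ i → κ i * sum (λ t → P i t * Q t s)) ≈⟨ sum-matrix κ P (λ t → Q t s) ⟩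
    sum (λ t → sum (λ i → κ i * P i t) * Q t s) ≈⟨ sum-zero _ (λ t → trans (*-congʳ {Q t s} {sum (λ i → κ i * P i t)} {0K} (mk≃ (κP≈0 t))) (zeroˡ (Q t s))) ⟩
    0K                                     ∎)
    where
    P : Fin _ → Fin _ → 𝒦
    P i = proj₁ (b∈Λ i)
    Q : Fin _ → Fin _ → 𝒦
    Q t = proj₁ (Λ⊆b (w t) (Mem-generator w t))
    κP≈0 : ∀ t → sum (λ i → κ i * P i t) ≈K 0K
    κP≈0 = KIndep-lincomb-rows w w-indep P b (λ i t' → mk≃ (proj₂ (proj₂ (b∈Λ i)) t')) κ κb≈0
    PQ≃δ : ∀ i s → sum (λ t → P i t * Q t s) ≃ δ s i
    PQ≃δ i = RIndep⇒coefficients-unique b b-indep _ _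
      (λ s → IsPoly-sum _ (λ t → IsPoly-⊗ {P i t} {Q t s} (proj₁ (proj₂ (b∈Λ i)) t) (proj₁ (proj₂ (Λ⊆b (w t) (Mem-generator w t))) s)))
      (λ s → IsPoly-δ s i)
      (λ t' → begin
        lincomb (λ s → sum (λ t → P i t * Q t s)) b t' ≈⟨ lincomb-lincomb (P i) Q b t' ⟨
        lincomb (P i) (λ t → lincomb (Q t) b) t'       ≈⟨ lincomb-cong (λ _ → refl) (λ t t'' → sym (mk≃ (proj₂ (proj₂ (Λ⊆b (w t) (Mem-generator w t))) t''))) t' ⟩
        lincomb (P i) w t'                             ≈⟨ mk≃ (proj₂ (proj₂ (b∈Λ i)) t') ⟨
        b i t'                                         ≈⟨ lincomb-δ b i t' ⟨
        lincomb (λ s → δ s i) b t'                     ∎)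

  KIndep-∷ : ∀ {n k r} (b : Fin k → Vec n) (g : Fin k → 𝒦) (ι : Fin r → Fin k) (j : Fin k) →
             KIndep b → Injective _≡_ _≡_ ι → (∀ t → ¬ (ι t ≡ j)) → (∀ κ → κ * g j ≃ 0K → κ ≃ 0K) →
             KIndep (lincomb g b ∷ (b ∘ ι))
  KIndep-∷ {r = r} b g ι j b-indep ι-inj ι≢j g-regular κ κY≈0 = κ≈0
    where
    M : Fin (suc r) → Fin _ → 𝒦
    M Fin.zero          = g
    M (Fin.suc t) i = δ i (ι t)
    Y≃ : ∀ p t → (lincomb g b ∷ (b ∘ ι)) p t ≃ lincomb (M p) b t
    Y≃ Fin.zero     t = refl
    Y≃ (Fin.suc t') t = sym (lincomb-δ b (ι t') t)
    rows : ∀ i → sum (λ p → κ p * M p i) ≈K 0K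
    rows = KIndep-lincomb-rows b b-indep M _ Y≃ κ κY≈0
    κ₀≈0 : κ Fin.zero ≃ 0K
    κ₀≈0 = g-regular (κ Fin.zero) (begin
      κ Fin.zero * g j      ≈⟨ +-identityʳ _ ⟨
      κ Fin.zero * g j + 0K ≈⟨ +-congˡ (sum-zero (λ t → κ (Fin.suc t) * δ j (ι t))
                                 (λ t → trans (*-congˡ {κ (Fin.suc t)} (δ-≢ (λ j≡ιt → ι≢j t (P.sym j≡ιt)))) (zeroʳ (κ (Fin.suc t))))) ⟨
      sum (λ p → κ p * M p j) ≈⟨ mk≃ (rows j) ⟩
      0K                    ∎)
    κ-suc≈0 : ∀ t₀ → κ (Fin.suc t₀) ≃ 0K
    κ-suc≈0 t₀ = begin
      κ (Fin.suc t₀)                                ≈⟨ sum-*-δ (κ ∘ Fin.suc) t₀ ⟨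
      sum (λ t → κ (Fin.suc t) * δ t t₀)            ≈⟨ sum-cong-≋ (λ t → *-congˡ {κ (Fin.suc t)} (trans (δ-sym t t₀) (sym (δ-injective ι ι-inj t₀ t)))) ⟩
      sum (λ t → κ (Fin.suc t) * δ (ι t₀) (ι t))    ≈⟨ +-identityˡ _ ⟨
      0K + sum (λ t → κ (Fin.suc t) * δ (ι t₀) (ι t)) ≈⟨ +-congʳ (trans (*-congʳ {g (ι t₀)} κ₀≈0) (zeroˡ (g (ι t₀)))) ⟨
      sum (λ p → κ p * M p (ι t₀))                  ≈⟨ mk≃ (rows (ι t₀)) ⟩
      0K                                            ∎
    κ≈0 : ∀ p → κ p ≈K 0K
    κ≈0 Fin.zero     = coeffwise κ₀≈0
    κ≈0 (Fin.suc t₀) = coeffwise (κ-suc≈0 t₀)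

  change-of-basis : ∀ {n k} (x y : Fin k → Vec n) (M N : Fin k → Fin k → 𝒦) → RIndep x →
                    (∀ i j → IsPoly (M i j)) → (∀ i j → IsPoly (N i j)) →
                    (∀ j t → y j t ≃ lincomb (λ i → M i j) x t) → (∀ j t → x j t ≃ lincomb (λ i → N i j) y t) →
                    ∀ i j → sum (λ t → M i t * N t j) ≃ δ i j
  change-of-basis x y M N x-indep M-poly N-poly y≃xM x≃yN i j =
    RIndep⇒coefficients-unique x x-indep (λ i → sum (λ t → M i t * N t j)) (λ i → δ i j)
      (λ i → IsPoly-sum _ (λ t → IsPoly-⊗ {M i t} {N t j} (M-poly i t) (N-poly t j))) (λ i → IsPoly-δ i j)
      (λ t' → begin
        lincomb (λ i → sum (λ t → M i t * N t j)) x t'       ≈⟨ lincomb-cong (λ i → sum-cong-≋ (λ t → *-comm (M i t) (N t j))) (λ _ _ → refl) t' ⟩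
        lincomb (λ i → sum (λ t → N t j * M i t)) x t'       ≈⟨ lincomb-lincomb (λ t → N t j) (λ t i → M i t) x t' ⟨
        lincomb (λ t → N t j) (λ t → lincomb (λ i → M i t) x) t' ≈⟨ lincomb-cong (λ _ → refl) (λ t t'' → y≃xM t t'') t' ⟨
        lincomb (λ t → N t j) y t'                           ≈⟨ x≃yN j t' ⟨
        x j t'                                               ≈⟨ lincomb-δ x j t' ⟨
        lincomb (λ i → δ i j) x t'                           ∎) i

∃-upper-bound : ∀ {k} (f : Fin k → ℤ) → ∃ λ B → ∀ i → f i ℤ.≤ B
∃-upper-bound {zero}  f = 0ℤ , λ ()
∃-upper-bound {suc k} f with ∃-upper-bound (f ∘ Fin.suc)
... | B , bound = f Fin.zero ℤ.⊔ B , λ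
  { Fin.zero    → ℤP.i≤i⊔j _ _
  ; (Fin.suc i) → ℤP.≤-trans (bound i) (ℤP.i≤j⊔i _ _) }

∃-argmax : ∀ {k} {P : Fin k → Set} → Decidable P → (f : Fin k → ℤ) → ∃ P →
           ∃ λ j → P j × (∀ i → P i → f i ℤ.≤ f j)
∃-argmax {suc k} {P} P? f (i , Pi) with FinP.any? (P? ∘ Fin.suc)
... | no ¬P∘suc = Fin.zero , P₀ i Pi , λ { Fin.zero _ → ℤP.≤-refl ; (Fin.suc t) Pt → ⊥-elim (¬P∘suc (t , Pt)) }
  where
  P₀ : ∀ i → P i → P Fin.zero
  P₀ Fin.zero    Pi = Pi
  P₀ (Fin.suc t) Pt = ⊥-elim (¬P∘suc (t , Pt))
... | yes witness with ∃-argmax (P? ∘ Fin.suc) (f ∘ Fin.suc) witness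
...   | j , Pj , max with P? Fin.zero | f Fin.zero ℤ.≤? f (Fin.suc j)
...     | no ¬P₀ | _ = Fin.suc j , Pj , λ { Fin.zero P₀ → ⊥-elim (¬P₀ P₀) ; (Fin.suc t) Pt → max t Pt }
...     | yes _  | yes f₀≤ = Fin.suc j , Pj , λ { Fin.zero _ → f₀≤ ; (Fin.suc t) Pt → max t Pt }
...     | yes P₀ | no f₀≰ = Fin.zero , P₀ , λ
  { Fin.zero _ → ℤP.≤-refl ; (Fin.suc t) Pt → ℤP.≤-trans (max t Pt) (ℤP.<⇒≤ (ℤP.≰⇒> f₀≰)) }

inject-injective : ∀ {k} {i : Fin k} → Injective _≡_ _≡_ (inject {i = i})
inject-injective {x = a} {b} ιa≡ιb =
  FinP.toℕ-injective (P.trans (P.sym (FinP.toℕ-inject a)) (P.trans (P.cong toℕ ιa≡ιb) (FinP.toℕ-inject b)))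

module FiniteFieldFacts (F : CommutativeRing 0ℓ 0ℓ) (q : ℕ) (𝔽-finite : IsFiniteField F q) where
  open CommutativeRing F renaming (Carrier to 𝔽)
  open IsFiniteField 𝔽-finite
  open SetoidReasoning setoid

  ≈0? : ∀ x → Dec (x ≈ 0#)
  ≈0? x with enum-surj x | enum-surj 0#
  ... | i , eᵢ≈x | i₀ , eᵢ₀≈0 with i Fin.≟ i₀
  ...   | yes P.refl = yes (trans (sym eᵢ≈x) eᵢ₀≈0)
  ...   | no i≢i₀    = no (λ x≈0 → i≢i₀ (enum-inj i i₀ (trans eᵢ≈x (trans x≈0 (sym eᵢ₀≈0)))))

  ≉0⇒*-cancel : ∀ ρ → ¬ (ρ ≈ 0#) → ∀ x → ρ * x ≈ 0# → x ≈ 0#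
  ≉0⇒*-cancel ρ ρ≉0 x ρx≈0 with inverse ρ ρ≉0
  ... | ρ⁻¹ , ρρ⁻¹≈1 = begin
    x             ≈⟨ *-identityˡ x ⟨
    1# * x        ≈⟨ *-congʳ ρρ⁻¹≈1 ⟨
    (ρ * ρ⁻¹) * x ≈⟨ *-congʳ (*-comm ρ ρ⁻¹) ⟩
    (ρ⁻¹ * ρ) * x ≈⟨ *-assoc ρ⁻¹ ρ x ⟩
    ρ⁻¹ * (ρ * x) ≈⟨ *-congˡ ρx≈0 ⟩
    ρ⁻¹ * 0#      ≈⟨ zeroʳ ρ⁻¹ ⟩
    0#            ∎

module CoefficientBound (F : CommutativeRing 0ℓ 0ℓ) (q : ℕ) (𝔽-finite : IsFiniteField F q)
  {n k : ℕ} (w : Fin k → Over.Vec F n) (lam : Fin k → ℤ)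
  (successive-minima : ∀ t → Over.IsSuccMin F w (suc (toℕ t)) (lam t))
  (b : Fin k → Over.Vec F n) (b-indep : Over.KIndep F b) (b∈Λ : ∀ i → Over.Mem F w (b i))
  (‖b‖≡λ : ∀ i → Over.NormEq F (b i) (lam i))
  (c : Fin k → Over.𝒦 F) (c-poly : ∀ i → Over.IsPoly F (c i))
  (E : ℤ) (‖cb‖≤E : Over.NormLe F (Over.lincomb F c b) E) where

  open CommutativeRing F renaming (Carrier to 𝔽)
  open Over F hiding (δ)
  open LaurentCoefficients F
  open LaurentRing F
  open LinearAlgebra F
  open FiniteFieldFacts F q 𝔽-finite
  open FiniteSums F using (sum; sum-cong-≋; sum-zero)
  module 𝒦R = CommutativeRing 𝒦-commutativeRing
  open SetoidReasoning setoid

  VanishesFrom : ℤ → Set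
  VanishesFrom D = ∀ i d → D ℤ.≤ d ℤ.+ lam i → coeff (c i) d ≈ 0#

  module Leading (D : ℤ) (E<D : E ℤ.< D) (above : VanishesFrom (D ℤ.+ 1ℤ)) where
    ρ : Fin k → 𝔽
    ρ i = coeff (c i) (D ℤ.- lam i)

    β : Fin k → Fin n → 𝔽
    β i s = coeff (b i s) (lam i)

    coeff-c⊗b : ∀ s i → coeff (c i ⊗ b i s) D ≈ ρ i * β i s
    coeff-c⊗b s i = trans (coeff-⊗-single (c i) (b i s) D (D ℤ.- lam i) high low) (*-congˡ (coeff-cong (b i s) (cancel D (lam i))))
      where
      cancel : ∀ D L → D ℤ.- (D ℤ.- L) ≡ L
      cancel = solve-∀
      identity-high : ∀ a D L → a ℤ.- (D ℤ.- L) ℤ.- 1ℤ ≡ a ℤ.+ L ℤ.- (D ℤ.+ 1ℤ)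
      identity-high = solve-∀
      identity-low : ∀ a D L → D ℤ.- L ℤ.- a ℤ.- 1ℤ ≡ D ℤ.- a ℤ.- L ℤ.- 1ℤ
      identity-low = solve-∀
      high : ∀ a → D ℤ.- lam i ℤ.< a → convolution (c i) (b i s) D a ≈ 0#
      high a lt = trans (*-congʳ (above i a (ℤP.0≤i-j⇒j≤i (0≤-resp-≡ (i<j⇒0≤j-i-1 lt) (identity-high a D (lam i)))))) (zeroˡ _)
      low : ∀ a → a ℤ.< D ℤ.- lam i → convolution (c i) (b i s) D a ≈ 0#
      low a lt = trans (*-congˡ (proj₁ (‖b‖≡λ i) s (D ℤ.- a) (0≤j-i-1⇒i<j (0≤-resp-≡ (i<j⇒0≤j-i-1 lt) (identity-low a D (lam i)))))) (zeroʳ _)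

    leading-relation : ∀ s → sum (λ i → ρ i * β i s) ≈ 0#
    leading-relation s = begin
      sum (λ i → ρ i * β i s)             ≈⟨ sum-cong-≋ (coeff-c⊗b s) ⟨
      sum (λ i → coeff (c i ⊗ b i s) D)   ≈⟨ coeff-lincomb c b s D ⟨
      coeff (lincomb c b s) D             ≈⟨ ‖cb‖≤E s D E<D ⟩
      0#                                  ∎

    -- y = Σ ρ i x^(λ j - λ i) b i lies in Λ because ρ i ≠ 0 forces λ i ≤ λ j; its
    -- x^(λ j)-coefficients cancel by leading-relation, so ‖y‖ < q^(λ j); and its
    -- b j-coordinate ρ j is nonzero, so it is independent of the b i with λ i < λ j.
    module ShortVector (j : Fin k) (ρj≉0 : ¬ ρ j ≈ 0#) (j-max : ∀ i → ¬ ρ i ≈ 0# → lam i ℤ.≤ lam j) where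
      g : Fin k → 𝒦
      g i = monomial (ρ i) (lam j ℤ.- lam i)

      g-poly : ∀ i → IsPoly (g i)
      g-poly i with ≈0? (ρ i)
      ... | yes ρi≈0 = IsPoly-zero-monomial (ρ i) (lam j ℤ.- lam i) ρi≈0
      ... | no ρi≉0  = IsPoly-monomial (ρ i) _ (ℤP.i≤j⇒0≤j-i (j-max i ρi≉0))

      g-regular : ∀ κ → κ ⊗ g j 𝒦R.≈ 0K → κ 𝒦R.≈ 0K
      g-regular κ (mk≃ κg≈0) = mk≃ λ d → trans (≉0⇒*-cancel (ρ j) ρj≉0 (coeff κ d) (begin
        ρ j * coeff κ d                       ≈⟨ *-congˡ (coeff-cong κ (P.sym (cancel d (lam j)))) ⟩
        ρ j * coeff κ (d ℤ.- (lam j ℤ.- lam j)) ≈⟨ coeff-monomial-⊗ (ρ j) (lam j ℤ.- lam j) κ d ⟨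
        coeff (g j ⊗ κ) d                     ≈⟨ ⊗-comm (g j) κ d ⟩
        coeff (κ ⊗ g j) d                     ≈⟨ κg≈0 d ⟩
        coeff 0K d                            ≈⟨ coeff-0K d ⟩
        0#                                    ∎)) (sym (coeff-0K d))
        where
        cancel : ∀ d J → d ℤ.- (J ℤ.- J) ≡ d
        cancel = solve-∀

      y : Vec n
      y = lincomb g b

      coeff-y : ∀ s d → coeff (y s) d ≈ sum (λ i → ρ i * coeff (b i s) (d ℤ.- (lam j ℤ.- lam i)))
      coeff-y s d = trans (coeff-lincomb g b s d) (sum-cong-≋ (λ i → coeff-monomial-⊗ (ρ i) (lam j ℤ.- lam i) (b i s) d))

      ‖y‖<λj : NormLe y (lam j ℤ.- 1ℤ)
      ‖y‖<λj s d λj-1<d with d ℤ.≟ lam j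
      ... | yes P.refl = trans (coeff-y s d) (trans (sum-cong-≋ (λ i → *-congˡ (coeff-cong (b i s) (cancel d (lam i)))))
                                                     (leading-relation s))
        where
        cancel : ∀ J L → J ℤ.- (J ℤ.- L) ≡ L
        cancel = solve-∀
      ... | no d≢λj = trans (coeff-y s d) (sum-zero _ (λ i → trans (*-congˡ (proj₁ (‖b‖≡λ i) s _ (above-λ i))) (zeroʳ _)))
        where
        identity-j : ∀ d J → d ℤ.- (J ℤ.- 1ℤ) ℤ.- 1ℤ ≡ d ℤ.- J
        identity-j = solve-∀
        λj<d : lam j ℤ.< d
        λj<d = ℤP.≤∧≢⇒< (ℤP.0≤i-j⇒j≤i (0≤-resp-≡ (i<j⇒0≤j-i-1 λj-1<d) (identity-j d (lam j)))) (λ λj≡d → d≢λj (P.sym λj≡d))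
        identity : ∀ d J L → d ℤ.- J ℤ.- 1ℤ ≡ d ℤ.- (J ℤ.- L) ℤ.- L ℤ.- 1ℤ
        identity = solve-∀
        above-λ : ∀ i → lam i ℤ.< d ℤ.- (lam j ℤ.- lam i)
        above-λ i = 0≤j-i-1⇒i<j (0≤-resp-≡ (i<j⇒0≤j-i-1 λj<d) (identity d (lam j) (lam i)))

      first-not-below : ∃ λ r → ¬ (lam r ℤ.< lam j) × (∀ (t : Fin′ r) → lam (inject t) ℤ.< lam j)
      first-not-below = FinP.¬∀⟶∃¬-smallest k (λ t → lam t ℤ.< lam j) (λ t → lam t ℤ.<? lam j)
                                             (λ all-below → ℤP.<-irrefl P.refl (all-below j))

      r : Fin k
      r = proj₁ first-not-below

      λj≤λr : lam j ℤ.≤ lam r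
      λj≤λr = ℤP.≮⇒≥ (proj₁ (proj₂ first-not-below))

      below-r : ∀ (t : Fin′ r) → lam (inject t) ℤ.< lam j
      below-r = proj₂ (proj₂ first-not-below)

      short-family : Fin (suc (toℕ r)) → Vec n
      short-family = y ∷ (b ∘ inject)

      short-family-indep : KIndep short-family
      short-family-indep = KIndep-∷ b g inject j b-indep inject-injective
        (λ t ιt≡j → ℤP.<-irrefl (P.cong lam ιt≡j) (below-r t)) g-regular

      short-family-short : ∀ p → Mem w (short-family p) × NormLe (short-family p) (lam j ℤ.- 1ℤ)
      short-family-short Fin.zero    = Mem-lincomb w b g b∈Λ g-poly , ‖y‖<λj
      short-family-short (Fin.suc t) = b∈Λ (inject t) , NormLe-mono (b (inject t)) (i<j⇒i≤j-1 (below-r t)) (proj₁ (‖b‖≡λ (inject t)))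

      -- These are toℕ r + 1 independent lattice vectors of norm < q^(lam r), while
      -- lam r is the (toℕ r + 1)-th successive minimum (lam is indexed from 0).
      absurd : ⊥
      absurd = proj₂ (successive-minima r)
        (DimAtLeast-mono w (suc (toℕ r)) (ℤP.+-monoˡ-≤ (ℤ.- 1ℤ) λj≤λr) (short-family , short-family-short , short-family-indep))

    leading-vanishes : ∀ i → ρ i ≈ 0#
    leading-vanishes i with ≈0? (ρ i)
    ... | yes ρi≈0 = ρi≈0
    ... | no ρi≉0 with ∃-argmax (λ t → ¬? (≈0? (ρ t))) lam (i , ρi≉0)
    ...   | j , ρj≉0 , j-max = ⊥-elim (ShortVector.absurd j ρj≉0 j-max)

  VanishesFrom-mono : ∀ {D D'} → D ℤ.≤ D' → VanishesFrom D → VanishesFrom D'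
  VanishesFrom-mono D≤D' vanish i d D'≤ = vanish i d (ℤP.≤-trans D≤D' D'≤)

  VanishesFrom-step : ∀ D → E ℤ.< D → VanishesFrom (D ℤ.+ 1ℤ) → VanishesFrom D
  VanishesFrom-step D E<D above i d D≤d+λ with D ℤ.+ 1ℤ ℤ.≤? d ℤ.+ lam i
  ... | yes D+1≤d+λ = above i d D+1≤d+λ
  ... | no D+1≰d+λ = trans (coeff-cong (c i) d≡) (Leading.leading-vanishes D E<D above i)
    where
    identity : ∀ D x → D ℤ.+ 1ℤ ℤ.- x ℤ.- 1ℤ ≡ D ℤ.- x
    identity = solve-∀
    level≡D : d ℤ.+ lam i ≡ D
    level≡D = ℤP.≤-antisym (ℤP.0≤i-j⇒j≤i (0≤-resp-≡ (i<j⇒0≤j-i-1 (ℤP.≰⇒> D+1≰d+λ)) (identity D (d ℤ.+ lam i)))) D≤d+λ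
    cancel : ∀ d L → d ≡ d ℤ.+ L ℤ.- L
    cancel = solve-∀
    d≡ : d ≡ D ℤ.- lam i
    d≡ = P.trans (cancel d (lam i)) (P.cong (λ x → x ℤ.- lam i) level≡D)

  VanishesFrom-descend : ∀ m → VanishesFrom (E ℤ.+ 1ℤ ℤ.+ + m) → VanishesFrom (E ℤ.+ 1ℤ)
  VanishesFrom-descend zero    vanish = P.subst VanishesFrom (ℤP.+-identityʳ (E ℤ.+ 1ℤ)) vanish
  VanishesFrom-descend (suc m) vanish = VanishesFrom-descend m
    (VanishesFrom-step (E ℤ.+ 1ℤ ℤ.+ + m) E<D (P.subst VanishesFrom D≡ vanish))
    where
    assoc : ∀ E m → E ℤ.+ 1ℤ ℤ.+ (1ℤ ℤ.+ m) ≡ E ℤ.+ 1ℤ ℤ.+ m ℤ.+ 1ℤ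
    assoc = solve-∀
    D≡ : E ℤ.+ 1ℤ ℤ.+ + suc m ≡ E ℤ.+ 1ℤ ℤ.+ + m ℤ.+ 1ℤ
    D≡ = P.trans (P.cong (λ x → E ℤ.+ 1ℤ ℤ.+ x) (ℤP.pos-+ 1 m)) (assoc E (+ m))
    gap : ∀ E m → m ≡ E ℤ.+ 1ℤ ℤ.+ m ℤ.- E ℤ.- 1ℤ
    gap = solve-∀
    E<D : E ℤ.< E ℤ.+ 1ℤ ℤ.+ + m
    E<D = 0≤j-i-1⇒i<j (0≤-resp-≡ (0≤+ m) (gap E (+ m)))

  VanishesFrom-above-tops : ∀ B → (∀ i → top (c i) ℤ.+ lam i ℤ.≤ B) → VanishesFrom (B ℤ.+ 1ℤ)
  VanishesFrom-above-tops B bound i d B+1≤ = coeff-above-top (c i) d (0≤j-i-1⇒i<j (0≤-resp-≡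
    (ℤP.+-mono-≤ (ℤP.i≤j⇒0≤j-i (bound i)) (ℤP.i≤j⇒0≤j-i B+1≤)) (identity (top (c i)) (lam i) B d)))
    where
    identity : ∀ T L B d → B ℤ.- (T ℤ.+ L) ℤ.+ (d ℤ.+ L ℤ.- (B ℤ.+ 1ℤ)) ≡ d ℤ.- T ℤ.- 1ℤ
    identity = solve-∀

  VanishesFrom-eventually : ∃ λ m → VanishesFrom (E ℤ.+ 1ℤ ℤ.+ + m)
  VanishesFrom-eventually with ∃-upper-bound (λ i → top (c i) ℤ.+ lam i)
  ... | B , bound with ℤP.≤-total (B ℤ.+ 1ℤ) (E ℤ.+ 1ℤ) | VanishesFrom-above-tops B bound
  ...   | inj₁ B+1≤E+1 | vanish = 0 , VanishesFrom-mono (ℤP.≤-trans B+1≤E+1 (ℤP.≤-reflexive (P.sym (ℤP.+-identityʳ _)))) vanish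
  ...   | inj₂ E+1≤B+1 | vanish with i≤j⇒∃[n]j≡i+n E+1≤B+1
  ...     | m , B+1≡ = m , P.subst VanishesFrom B+1≡ vanish

  coefficient-bound : ∀ i → AbsLe (c i) (E ℤ.- lam i)
  coefficient-bound i d E-λ<d = VanishesFrom-descend m vanish i d (ℤP.0≤i-j⇒j≤i (0≤-resp-≡ (i<j⇒0≤j-i-1 E-λ<d) (identity E (lam i) d)))
    where
    m : ℕ
    m = proj₁ VanishesFrom-eventually
    vanish : VanishesFrom (E ℤ.+ 1ℤ ℤ.+ + m)
    vanish = proj₂ VanishesFrom-eventually
    identity : ∀ E L d → d ℤ.- (E ℤ.- L) ℤ.- 1ℤ ≡ d ℤ.+ L ℤ.- (E ℤ.+ 1ℤ)
    identity = solve-∀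

-- Mutually inverse polynomial matrices with |a i j|, |c i j| ≤ q^(λ j - λ i) have
-- mutually inverse constant-term blocks on each level set of λ: the terms through
-- an index t outside the block vanish, as λ t < λ i or λ t > λ j.
module GradedInverse (F : CommutativeRing 0ℓ 0ℓ) {k : ℕ} (lam : Fin k → ℤ)
  (a c : Fin k → Fin k → Over.𝒦 F) (a-poly : ∀ i j → Over.IsPoly F (a i j)) (c-poly : ∀ i j → Over.IsPoly F (c i j))
  (a-bound : ∀ i j → Over.AbsLe F (a i j) (lam j ℤ.- lam i)) (c-bound : ∀ i j → Over.AbsLe F (c i j) (lam j ℤ.- lam i))
  where

  open CommutativeRing F renaming (Carrier to 𝔽)
  open Over F
  open LaurentCoefficients F
  open LaurentRing F
  open LinearAlgebra F using (coeff₀-⊗; coeff-sum)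
  open FiniteSums F using (sum; sum-cong-≋; sumFin≈sum)
  module 𝒦R = CommutativeRing 𝒦-commutativeRing
  module Σ𝒦 = FiniteSums 𝒦-commutativeRing
  open SetoidReasoning setoid

  A C : Fin k → Fin k → 𝔽
  A i j = coeff (a i j) 0ℤ
  C i j = coeff (c i j) 0ℤ

  coeff₀-δ : ∀ (i j : Fin k) → coeff (Over.δ 𝒦-commutativeRing i j) 0ℤ ≈ δ i j
  coeff₀-δ i j with i Fin.≟ j
  ... | yes _ = coeff-monomial 1# 0ℤ
  ... | no _ = coeff-0K 0ℤ

  constant-terms-inverse : ∀ (M N : Fin k → Fin k → 𝒦) → (∀ i j → IsPoly (M i j)) → (∀ i j → IsPoly (N i j)) →
                           (∀ i j → Σ𝒦.sum (λ t → M i t ⊗ N t j) 𝒦R.≈ Over.δ 𝒦-commutativeRing i j) →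
                           ∀ i j → sum (λ t → coeff (M i t) 0ℤ * coeff (N t j) 0ℤ) ≈ δ i j
  constant-terms-inverse M N M-poly N-poly MN≃1 i j = begin
    sum (λ t → coeff (M i t) 0ℤ * coeff (N t j) 0ℤ) ≈⟨ sum-cong-≋ (λ t → coeff₀-⊗ (M i t) (N t j) (M-poly i t) (N-poly t j)) ⟨
    sum (λ t → coeff (M i t ⊗ N t j) 0ℤ)            ≈⟨ coeff-sum (λ t → M i t ⊗ N t j) 0ℤ ⟨
    coeff (Σ𝒦.sum (λ t → M i t ⊗ N t j)) 0ℤ         ≈⟨ coeffwise (MN≃1 i j) 0ℤ ⟩
    coeff (Over.δ 𝒦-commutativeRing i j) 0ℤ         ≈⟨ coeff₀-δ i j ⟩
    δ i j                                           ∎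

  sumOn≈sum : ∀ (P : Fin k → _) (f : Fin k → 𝔽) → (∀ t → ¬ T (P t) → f t ≈ 0#) → sumOn P f ≈ sum f
  sumOn≈sum P f f≈0 = trans (sumFin≈sum (λ t → if P t then f t else 0#)) (sum-cong-≋ on-P)
    where
    on-P : ∀ t → (if P t then f t else 0#) ≈ f t
    on-P t with P t | f≈0 t
    ... | true  | _    = refl
    ... | false | ft≈0 = sym (ft≈0 (λ ()))

  inI⇒≡ : ∀ μ t → T (inI lam μ t) → lam t ≡ μ
  inI⇒≡ μ t t∈ with lam t ℤ.≟ μ
  ... | yes λt≡μ = λt≡μ

  ≡⇒inI : ∀ μ t → lam t ≡ μ → T (inI lam μ t)
  ≡⇒inI μ t λt≡μ with lam t ℤ.≟ μ
  ... | yes _    = _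
  ... | no λt≢μ  = λt≢μ λt≡μ

  outside-level : ∀ μ t → ¬ T (inI lam μ t) → lam t ℤ.< μ ⊎ μ ℤ.< lam t
  outside-level μ t t∉ with ℤP.<-cmp (lam t) μ
  ... | tri< λt<μ _ _ = inj₁ λt<μ
  ... | tri≈ _ λt≡μ _ = ⊥-elim (t∉ (≡⇒inI μ t λt≡μ))
  ... | tri> _ _ μ<λt = inj₂ μ<λt

  constant-term-vanishes : ∀ (M : Fin k → Fin k → 𝒦) → (∀ i j → AbsLe (M i j) (lam j ℤ.- lam i)) →
                           ∀ i j → lam j ℤ.< lam i → coeff (M i j) 0ℤ ≈ 0#
  constant-term-vanishes M M-bound i j λj<λi = M-bound i j 0ℤ (i<j⇒i-j<0 λj<λi)

  block-inverse : (∀ i j → Σ𝒦.sum (λ t → a i t ⊗ c t j) 𝒦R.≈ Over.δ 𝒦-commutativeRing i j) →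
                  (∀ i j → Σ𝒦.sum (λ t → c i t ⊗ a t j) 𝒦R.≈ Over.δ 𝒦-commutativeRing i j) →
                  ∀ μ → InvertibleOn (inI lam μ) A
  block-inverse ac≃1 ca≃1 μ = C , λ i j i∈ j∈ →
      trans (sumOn≈sum (inI lam μ) _ (off-block a c a-bound c-bound i j i∈ j∈)) (constant-terms-inverse a c a-poly c-poly ac≃1 i j)
    , trans (sumOn≈sum (inI lam μ) _ (off-block c a c-bound a-bound i j i∈ j∈)) (constant-terms-inverse c a c-poly a-poly ca≃1 i j)
    where
    off-block : ∀ (M N : Fin k → Fin k → 𝒦) → (∀ i j → AbsLe (M i j) (lam j ℤ.- lam i)) → (∀ i j → AbsLe (N i j) (lam j ℤ.- lam i)) →
                ∀ i j → T (inI lam μ i) → T (inI lam μ j) → ∀ t → ¬ T (inI lam μ t) → coeff (M i t) 0ℤ * coeff (N t j) 0ℤ ≈ 0#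
    off-block M N M-bound N-bound i j i∈ j∈ t t∉ with outside-level μ t t∉
    ... | inj₁ λt<μ = trans (*-congʳ (constant-term-vanishes M M-bound i t (P.subst (lam t ℤ.<_) (P.sym (inI⇒≡ μ i i∈)) λt<μ))) (zeroˡ _)
    ... | inj₂ μ<λt = trans (*-congˡ (constant-term-vanishes N N-bound t j (P.subst (ℤ._< lam t) (P.sym (inI⇒≡ μ j j∈)) μ<λt))) (zeroʳ _)

module BasisChange (F : CommutativeRing 0ℓ 0ℓ) (q : ℕ) (𝔽-finite : IsFiniteField F q)
  {n k : ℕ} (w : Fin k → Over.Vec F n) (w-indep : Over.KIndep F w) (lam : Fin k → ℤ)
  (successive-minima : ∀ t → Over.IsSuccMin F w (suc (toℕ t)) (lam t))
  (v : Fin k → Over.Vec F n) (v-basis : Over.IsRBasis F w v) (‖v‖≡λ : ∀ i → Over.NormEq F (v i) (lam i))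
  (a : Fin k → Fin k → Over.𝒦 F) (a-poly : ∀ i j → Over.IsPoly F (a i j))
  (u-basis : Over.IsRBasis F w (λ j → Over.lincomb F (λ i → a i j) v))
  (‖u‖≡λ : ∀ j → Over.NormEq F (Over.lincomb F (λ i → a i j) v) (lam j)) where

  open CommutativeRing F renaming (Carrier to 𝔽)
  open Over F hiding (δ)
  open LaurentRing F
  open LinearAlgebra F
  module 𝒦R = CommutativeRing 𝒦-commutativeRing

  u : Fin k → Vec n
  u j = lincomb (λ i → a i j) v

  v∈u : ∀ j → Mem u (v j)
  v∈u j = proj₁ (proj₂ u-basis) (v j) (proj₁ v-basis j)

  c : Fin k → Fin k → 𝒦
  c i j = proj₁ (v∈u j) i

  c-poly : ∀ i j → IsPoly (c i j)
  c-poly i j = proj₁ (proj₂ (v∈u j)) i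

  v≃uc : ∀ j t → v j t 𝒦R.≈ lincomb (λ i → c i j) u t
  v≃uc j t = mk≃ (proj₂ (proj₂ (v∈u j)) t)

  a-bound : ∀ i j → AbsLe (a i j) (lam j ℤ.- lam i)
  a-bound i j = coefficient-bound i
    where open CoefficientBound F q 𝔽-finite w lam successive-minima
                 v (IsRBasis⇒KIndep w v w-indep v-basis) (proj₁ v-basis) ‖v‖≡λ
                 (λ i → a i j) (λ i → a-poly i j) (lam j) (proj₁ (‖u‖≡λ j))

  c-bound : ∀ i j → AbsLe (c i j) (lam j ℤ.- lam i)
  c-bound i j = coefficient-bound i
    where
    ‖uc‖≤λ : NormLe (lincomb (λ i → c i j) u) (lam j)
    ‖uc‖≤λ t d λ<d = trans (sym (coeffwise (v≃uc j t) d)) (proj₁ (‖v‖≡λ j) t d λ<d)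
    open CoefficientBound F q 𝔽-finite w lam successive-minima
           u (IsRBasis⇒KIndep w u w-indep u-basis) (proj₁ u-basis) ‖u‖≡λ
           (λ i → c i j) (λ i → c-poly i j) (lam j) ‖uc‖≤λ

  open GradedInverse F lam a c a-poly c-poly a-bound c-bound
    renaming (block-inverse to block-inverse′) using ()

  block-inverse : ∀ μ → InvertibleOn (inI lam μ) (λ i j → coeff (a i j) 0ℤ)
  block-inverse = block-inverse′
    (change-of-basis v u a c (proj₂ (proj₂ v-basis)) a-poly c-poly (λ j t → 𝒦R.refl) v≃uc)
    (change-of-basis u v c a (proj₂ (proj₂ u-basis)) c-poly a-poly v≃uc (λ j t → 𝒦R.refl))

proposition5p2 : (F : CommutativeRing 0ℓ 0ℓ) (q : ℕ) → IsFiniteField F q →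
    let open Over F in
    (n k m : ℕ) → 1 ℕ.≤ k → k ℕ.≤ n → 1 ℕ.≤ m →
    (e : Fin m → ℤ) → (∀ ℓ ℓ' → ℓ Fin.< ℓ' → e ℓ ℤ.< e ℓ') →
    (s : Fin m → ℕ) →
    (w : Fin k → Vec n) → KIndep w →
    (lam : Fin k → ℤ) → (∀ t → IsSuccMin w (suc (toℕ t)) (lam t)) →
    IsMuS lam e s →
    (v : Fin k → Vec n) → IsRBasis w v → (∀ i → NormEq (v i) (lam i)) →
    (a : Fin k → Fin k → 𝒦) → (∀ i j → IsPoly (a i j)) →
    IsRBasis w (λ j → lincomb (λ i → a i j) v) →
    (∀ j → NormEq (lincomb (λ i → a i j) v) (lam j)) →
    (∀ ℓ i j → lam i ≡ e ℓ → lam j ≡ e ℓ → AbsLe (a i j) (+ 0))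
    × (∀ ℓ' ℓ i j → ℓ' Fin.< ℓ → lam i ≡ e ℓ' → lam j ≡ e ℓ → AbsLe (a i j) (e ℓ ℤ.- e ℓ'))
    × (∀ ℓ ℓ' i j → ℓ Fin.< ℓ' → lam i ≡ e ℓ' → lam j ≡ e ℓ → a i j ≈K 0K)
    × (∀ ℓ → InvertibleOn (inI lam (e ℓ)) (λ i j → coeff (a i j) (+ 0)))
-- Only the successive minima enter the argument.
proposition5p2 F q 𝔽-finite n k m _ _ _ e e-mono s w w-indep lam successive-minima _ v v-basis ‖v‖≡λ a a-poly u-basis ‖u‖≡λ =
    (λ ℓ i j λi≡ λj≡ → P.subst (AbsLe (a i j)) (P.trans (P.cong₂ ℤ._-_ λj≡ λi≡) (ℤP.+-inverseʳ (e ℓ))) (a-bound i j))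
  , (λ ℓ' ℓ i j _ λi≡ λj≡ → P.subst (AbsLe (a i j)) (P.cong₂ ℤ._-_ λj≡ λi≡) (a-bound i j))
  , (λ ℓ ℓ' i j ℓ<ℓ' λi≡ λj≡ → IsPoly∧AbsLe-negative⇒≈0 {a i j} (a-poly i j) (a-bound i j)
       (P.subst (ℤ._< 0ℤ) (P.sym (P.cong₂ ℤ._-_ λj≡ λi≡)) (i<j⇒i-j<0 (e-mono ℓ ℓ' ℓ<ℓ'))))
  , (λ ℓ → block-inverse (e ℓ))
  where
  open Over F
  open LinearAlgebra F using (IsPoly∧AbsLe-negative⇒≈0)
  open BasisChange F q 𝔽-finite w w-indep lam successive-minima v v-basis ‖v‖≡λ a a-poly u-basis ‖u‖≡λ
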